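{- Let $\mathcal L$ be a finite distributive lattice and $U_o\sqcup U_c=\mathcal P(\mathcal L)$ a partition of its set of join-irreducible elements. Then the ideal $I^{U_o,U_c}(\mathcal L)$ is generated by the elements $X_aX_b-X_{a\vee b}X_{a\odot_{U_o,U_c}b}$ with $\{a,b\}$ ranging over incomparable pairs in $\mathcal L$.
   Context: $\mathcal P(\mathcal L)$ is the poset of join-irreducible elements (non-minimal elements covering exactly one element); $\iota(a)=\{p\in\mathcal P(\mathcal L):p\le a\}$, and $\iota$ is a lattice isomorphism from $\mathcal L$ onto the lattice of order ideals (lower sets) of $\mathcal P(\mathcal L)$ under union and intersection. For an order ideal $J$, $K(J)=K_{U_o,U_c}(J)$ is the set of elements of $J\cap U_o$ together with the elements of $J\cap U_c$ maximal in $J$. For order ideals $J_1,J_2$ there is a unique order ideal $J'$ with $\mathbf 1_{K(J_1)}+\mathbf 1_{K(J_2)}=\mathbf 1_{K(J_1\cup J_2)}+\mathbf 1_{K(J')}$ (indicator functions); write $J'=J_1\odot_{U_o,U_c}J_2$ and $a\odot_{U_o,U_c}b=\iota^{ -1}(\iota(a)\odot_{U_o,U_c}\iota(b))$. $R=\mathbb{C}[X_a:a\in\mathcal L]$ and $I^{U_o,U_c}(\mathcal L)$ is the kernel of $R\to\mathbb{C}[z_p\,(p\in\mathcal P(\mathcal L)),t]$, $X_a\mapsto t\prod_{p\in K(\iota(a))}z_p$. -}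

module Defs where

open import Level using (Level; _⊔_) renaming (suc to lsuc)
open import Data.Nat as ℕ using (ℕ; zero; suc)
open import Data.Fin as Fin using (Fin)
open import Data.Bool as Bool using (Bool; true; false; not; _∧_; _∨_; if_then_else_)
open import Data.List as List using (List; []; _∷_; _++_; allFin; filterᵇ; length; map; concatMap; foldr)
open import Data.Bool.ListAction using (any)
open import Data.List.Relation.Unary.All using (All)
open import Data.Vec as Vec using (Vec; tabulate; zipWith; lookup)
open import Data.Vec.Properties using (≡-dec)
open import Data.Product using (Σ; ∃; _×_; _,_; proj₁; proj₂)
open import Relation.Nullary using (¬_; yes; no)
open import Relation.Nullary.Decidable using (⌊_⌋)
open import Relation.Binary.PropositionalEquality using (_≡_)
open import Algebra.Bundles using (CommutativeRing)
import Algebra.Lattice.Structures as LS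

record Field (c ℓ : Level) : Set (lsuc (c ⊔ ℓ)) where
  field
    commutativeRing : CommutativeRing c ℓ
  open CommutativeRing commutativeRing public
  field
    1≉0     : ¬ (1# ≈ 0#)
    inverse : ∀ x → ¬ (x ≈ 0#) → ∃ λ y → x * y ≈ 1#

record FinDistLattice : Set where
  field
    size  : ℕ
    _⊔ᴸ_  : Fin size → Fin size → Fin size
    _⊓ᴸ_  : Fin size → Fin size → Fin size
    isDistributiveLattice : LS.IsDistributiveLattice (_≡_ {A = Fin size}) _⊔ᴸ_ _⊓ᴸ_

module LatticeNotions (L : FinDistLattice) where
  open FinDistLattice L public

  Elt : Set
  Elt = Fin size

  elts : List Elt
  elts = allFin size

  _≤ᵇ_ : Elt → Elt → Bool
  a ≤ᵇ b = ⌊ (a ⊔ᴸ b) Fin.≟ b ⌋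

  _<ᵇ_ : Elt → Elt → Bool
  a <ᵇ b = (a ≤ᵇ b) ∧ not ⌊ a Fin.≟ b ⌋

  covers : Elt → Elt → Bool
  covers p q = (q <ᵇ p) ∧ not (any (λ r → (q <ᵇ r) ∧ (r <ᵇ p)) elts)

  -- join-irreducible: covers exactly one element
  -- (in particular it is non-minimal)
  isJI : Elt → Bool
  isJI p = ⌊ length (filterᵇ (covers p) elts) ℕ.≟ 1 ⌋

  _≤_ : Elt → Elt → Set
  a ≤ b = a ⊔ᴸ b ≡ b

  Incomparable : Elt → Elt → Set
  Incomparable a b = ¬ (a ≤ b) × ¬ (b ≤ a)

  -- A partition U_o ⊔ U_c of the join-irreducibles is given by a colouring
  -- open? : Elt → Bool ; U_o = {p join-irreducible | open? p = true},
  -- U_c = {p join-irreducible | open? p = false}.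
  module WithPartition (open? : Elt → Bool) where

    -- membership  p ∈ K(ι(a)) :  p ∈ ι(a) (join-irreducible, p ≤ a), and
    -- either p ∈ U_o, or p ∈ U_c and p is maximal in ι(a).
    inK : Elt → Elt → Bool
    inK a p = isJI p ∧ (p ≤ᵇ a) ∧
              (open? p ∨ not (any (λ q → isJI q ∧ (q ≤ᵇ a) ∧ (p <ᵇ q)) elts))

    𝟏 : Bool → ℕ
    𝟏 b = if b then 1 else 0

    -- c = a ⊙ b :  1_{K(ι a)} + 1_{K(ι b)} = 1_{K(ι (a ∨ b))} + 1_{K(ι c)}
    -- (using ι(a) ∪ ι(b) = ι(a ∨ b) and that ι is a bijection onto ideals)
    IsOdot : Elt → Elt → Elt → Set
    IsOdot a b c = ∀ p → isJI p ≡ true →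
      𝟏 (inK a p) ℕ.+ 𝟏 (inK b p) ≡ 𝟏 (inK (a ⊔ᴸ b) p) ℕ.+ 𝟏 (inK c p)

module Polynomials {c ℓ : Level} (R : CommutativeRing c ℓ) where
  open CommutativeRing R

  Mon : ℕ → Set
  Mon m = Vec ℕ m

  Poly : ℕ → Set c
  Poly m = List (Carrier × Mon m)

  coeff : ∀ {m} → Poly m → Mon m → Carrier
  coeff [] μ = 0#
  coeff ((a , ν) ∷ f) μ with ≡-dec ℕ._≟_ ν μ
  ... | yes _ = a + coeff f μ
  ... | no  _ = coeff f μ

  _≋_ : ∀ {m} → Poly m → Poly m → Set ℓ
  f ≋ g = ∀ μ → coeff f μ ≈ coeff g μ

  0P : ∀ {m} → Poly m
  0P = []

  _+P_ : ∀ {m} → Poly m → Poly m → Poly m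
  _+P_ = _++_

  -P_ : ∀ {m} → Poly m → Poly m
  -P_ = map (λ t → (- proj₁ t , proj₂ t))

  _*P_ : ∀ {m} → Poly m → Poly m → Poly m
  f *P g = concatMap (λ s → map (λ t → (proj₁ s * proj₁ t , zipWith ℕ._+_ (proj₂ s) (proj₂ t))) g) f

  var : ∀ {m} → Fin m → Poly m
  var i = (1# , tabulate (λ j → if ⌊ i Fin.≟ j ⌋ then 1 else 0)) ∷ []

  sumP : ∀ {m} → List (Poly m) → Poly m
  sumP = foldr _+P_ 0P

  _∈⟨_⟩ : ∀ {m} {g : Level} → Poly m → (Poly m → Set g) → Set (c ⊔ ℓ ⊔ g)
  f ∈⟨ G ⟩ = Σ (List (Poly _ × Poly _)) λ hs →
               All (λ hg → G (proj₂ hg)) hs ×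
               (f ≋ sumP (map (λ hg → proj₁ hg *P proj₂ hg) hs))

  mapMon : ∀ {m k} → (Mon m → Mon k) → Poly m → Poly k
  mapMon φ = map (λ t → (proj₁ t , φ (proj₂ t)))

module HibiType {c ℓ : Level} (K : Field c ℓ) (L : FinDistLattice) (open? : Fin (FinDistLattice.size L) → Bool) where
  open Field K using (commutativeRing)
  open Polynomials commutativeRing public
  open LatticeNotions L public
  open WithPartition open? public

  sumℕ : List ℕ → ℕ
  sumℕ = foldr ℕ._+_ 0

  -- Target ring C[t, z_p (p ∈ L)]: variable 0 is t, variable (suc p) is z_p.
  -- (Only z_p with p join-irreducible ever occur.)
  -- X_a ↦ t ∏_{p ∈ K(ι a)} z_p, so X^ν ↦ t^{Σ ν_a} ∏_p z_p^{Σ_a ν_a [p ∈ K(ι a)]}.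
  φMon : Mon size → Mon (suc size)
  φMon ν = sumℕ (map (λ a → lookup ν a) elts)
           Vec.∷ tabulate (λ p → sumℕ (map (λ a → lookup ν a ℕ.* 𝟏 (inK a p)) elts))

  -- f ∈ I^{U_o,U_c}(L)  iff  φ(f) = 0
  InKernel : Poly size → Set ℓ
  InKernel f = mapMon φMon f ≋ 0P

  X : Elt → Poly size
  X = var

  Generator : Poly size → Set c
  Generator g = Σ Elt λ a → Σ Elt λ b → Σ Elt λ d →
    Incomparable a b × IsOdot a b d ×
    (g ≡ ((X a *P X b) +P (-P (X (a ⊔ᴸ b) *P X d))))

-- The map X_a ↦ t ∏_{p ∈ K(ι a)} z_p sends monomials to monomials, so its kernel is spanned by the
-- binomials X^u − X^v with equal images: along the fibre of the first monomial of a kernel element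
-- the coefficients sum to zero. It remains to connect any two monomials with equal images by moves
-- X_a X_b ↦ X_{a∨b} X_{a⊙b} with {a,b} incomparable. Replacing the first two factors by their join
-- and a second element, repeatedly, gathers the join x of all factors in front. A join-irreducible p
-- lies below x iff it lies below some q whose z_q occurs in the image (take q maximal in ι(a) above p;
-- it is in K(ι a) whether open or closed), so x is determined by the image; cancelling X_x and
-- inducting on the degree connects the fibre. The element a ⊙ b itself is the join of the
-- join-irreducibles of ι(a) ∩ ι(b) that are open or maximal in ι(a) or in ι(b); this set is exactly
-- K(ι(a ⊙ b)), and the indicator identity is then a pointwise boolean check.

module Submission where

open import Defs
open import Level using (Level; 0ℓ)
open import Algebra.Lattice.Bundles using (Lattice)
open import Algebra.Bundles using (CommutativeRing)
import Algebra.Lattice.Structures as LS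
open import Data.Bool using (Bool; true; false; not; _∧_; _∨_; T; if_then_else_)
open import Data.Bool.ListAction using (any)
open import Data.Bool.Properties using (T?; T-∧; T-∨; T-≡)
import Data.Bool.Properties as Boolₚ
open import Data.Fin using (Fin; zero; suc)
open import Data.Fin.Induction using (spo-wellFounded)
import Data.Fin.Properties as Finₚ
open import Data.List using (List; []; _∷_; _++_; filterᵇ; filter; length; map; foldr; foldl; concat; allFin)
import Data.List as List
import Data.List.Properties as Listₚ
open import Data.List.Membership.Propositional using (_∈_; lose; find)
open import Data.List.Membership.Propositional.Properties using (∈-allFin; ∈-filter⁺; ∈-filter⁻)
open import Data.List.Relation.Binary.Pointwise using (Pointwise; []; _∷_)
open import Data.List.Relation.Unary.All using (All; []; _∷_)
import Data.List.Relation.Unary.All as All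
import Data.List.Relation.Unary.All.Properties as Allₚ
open import Data.List.Relation.Unary.Any using (Any; here; there; satisfied)
import Data.List.Relation.Unary.Any as Any
open import Data.List.Relation.Unary.Any.Properties using (any⁺; any⁻)
open import Data.Nat as ℕ using (ℕ)
open import Data.Nat.ListAction using (sum)
import Data.Nat.Induction as ℕ
import Data.Nat.Properties as ℕₚ
open import Data.Product using (∃; _×_; _,_; proj₁; proj₂)
import Data.Product as Product
open import Data.Sum using (_⊎_; inj₁; inj₂; [_,_]′)
import Data.Sum
open import Data.Vec using (Vec; _∷_; []; lookup; replicate; zipWith; tabulate)
import Data.Vec.Properties as Vecₚ
open import Data.Vec.Relation.Binary.Pointwise.Inductive using (Pointwise-≡⇒≡; zipWith-comm; zipWith-assoc; zipWith-identityˡ)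
open import Function using (_∘_; flip)
open import Function.Bundles using (_⇔_; mk⇔; module Equivalence)
open Equivalence using (to; from)
open import Induction.WellFounded using (WellFounded; Acc; acc)
open import Relation.Binary using (IsPartialOrder; IsEquivalence; Decidable)
import Relation.Binary.Construct.Closure.Equivalence as EqClosure
open EqClosure using (EqClosure)
import Relation.Binary.Construct.Flip.EqAndOrd as Flip
import Relation.Binary.Construct.NonStrictToStrict as ToStrict
import Relation.Binary.Construct.On as On
open import Relation.Binary.PropositionalEquality using (_≡_; _≢_; refl; sym; trans; cong; cong₂; subst; module ≡-Reasoning)
import Relation.Binary.PropositionalEquality as ≡
open import Relation.Nullary using (¬_; yes; no; contradiction)
open import Relation.Nullary.Decidable using (⌊_⌋; toWitness; fromWitness; _×-dec_; ¬?; decidable-stable; toSum)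
import Relation.Unary as U
open import Relation.Unary.Properties using (∁?)

T-not⇔¬T : ∀ {b} → T (not b) ⇔ (¬ T b)
T-not⇔¬T {false} = mk⇔ (λ _ ()) (λ _ → _)
T-not⇔¬T {true}  = mk⇔ (λ ()) (λ ¬t → ¬t _)

T-any⇔ : ∀ {n} (f : Fin n → Bool) → T (any f (allFin n)) ⇔ ∃ (T ∘ f)
T-any⇔ {n} f = mk⇔ (satisfied ∘ any⁻ f (allFin n)) (λ (i , fi) → any⁺ f (lose {P = T ∘ f} (∈-allFin i) fi))

T-none⇔ : ∀ {n} (f : Fin n → Bool) → T (not (any f (allFin n))) ⇔ (∀ i → ¬ T (f i))
T-none⇔ f = mk⇔ (λ h i fi → to T-not⇔¬T h (from (T-any⇔ f) (i , fi)))
                (λ none → from T-not⇔¬T λ h → let i , fi = to (T-any⇔ f) h in none i fi)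

T-∧∧∨⇔ : ∀ j l o m → T (j ∧ l ∧ (o ∨ m)) ⇔ (T j × T l × (T o ⊎ T m))
T-∧∧∨⇔ j l o m = mk⇔
  (Product.map₂ (Product.map₂ (to (T-∨ {o})) ∘ to (T-∧ {l})) ∘ to (T-∧ {j}))
  (from (T-∧ {j}) ∘ Product.map₂ (from (T-∧ {l}) ∘ Product.map₂ (from (T-∨ {o}))))

T⇔T⇒≡ : ∀ {x y} → T x ⇔ T y → x ≡ y
T⇔T⇒≡ {false} {false} _ = refl
T⇔T⇒≡ {false} {true}  e = contradiction (from e _) λ ()
T⇔T⇒≡ {true}  {false} e = contradiction (to e _) λ ()
T⇔T⇒≡ {true}  {true}  _ = refl

module _ {A : Set} (P : A → Bool) where

  length-filterᵇ-tabulate≡0⇔ : ∀ {n} (f : Fin n → A) →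
    length (filterᵇ P (List.tabulate f)) ≡ 0 ⇔ (∀ i → ¬ T (P (f i)))
  length-filterᵇ-tabulate≡0⇔ f = mk⇔ (sound f) (complete f)
    where
    sound : ∀ {n} (f : Fin n → A) → length (filterᵇ P (List.tabulate f)) ≡ 0 → ∀ i → ¬ T (P (f i))
    sound {ℕ.suc n} f h i with P (f zero) in eq
    sound f () i | true
    sound f h zero    | false = subst T eq
    sound f h (suc i) | false = sound (f ∘ suc) h i
    complete : ∀ {n} (f : Fin n → A) → (∀ i → ¬ T (P (f i))) → length (filterᵇ P (List.tabulate f)) ≡ 0
    complete {ℕ.zero} f none = refl
    complete {ℕ.suc n} f none with P (f zero) in eq
    ... | true  = contradiction (subst T (sym eq) _) (none zero)
    ... | false = complete (f ∘ suc) (none ∘ suc)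

  length-filterᵇ-tabulate≡1⇔ : ∀ {n} (f : Fin n → A) →
    length (filterᵇ P (List.tabulate f)) ≡ 1 ⇔ ∃ λ i → T (P (f i)) × ∀ j → T (P (f j)) → j ≡ i
  length-filterᵇ-tabulate≡1⇔ f = mk⇔ (sound f) (complete f)
    where
    sound : ∀ {n} (f : Fin n → A) → length (filterᵇ P (List.tabulate f)) ≡ 1 →
         ∃ λ i → T (P (f i)) × ∀ j → T (P (f j)) → j ≡ i
    sound {ℕ.suc n} f h with P (f zero) in eq
    ... | true = zero , subst T (sym eq) _ , λ where
      zero    _  → refl
      (suc j) Pj → contradiction Pj (to (length-filterᵇ-tabulate≡0⇔ (f ∘ suc)) (ℕₚ.suc-injective h) j)
    ... | false with sound (f ∘ suc) h
    ...   | i , Pi , unique = suc i , Pi , λ where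
      zero    Pj → contradiction (subst T eq Pj) λ ()
      (suc j) Pj → cong suc (unique j Pj)
    complete : ∀ {n} (f : Fin n → A) → (∃ λ i → T (P (f i)) × ∀ j → T (P (f j)) → j ≡ i) →
           length (filterᵇ P (List.tabulate f)) ≡ 1
    complete {ℕ.suc n} f (i , Pi , unique) with P (f zero) in eq
    complete f (zero , Pi , unique) | true =
      cong ℕ.suc (from (length-filterᵇ-tabulate≡0⇔ (f ∘ suc)) λ j Pj → contradiction (unique (suc j) Pj) λ ())
    complete f (suc i , Pi , unique) | true = contradiction (unique zero (subst T (sym eq) _)) λ ()
    complete f (zero , Pi , unique) | false = contradiction (subst T eq Pi) λ ()
    complete f (suc i , Pi , unique) | false = complete (f ∘ suc) (i , Pi , λ j Pj → Finₚ.suc-injective (unique (suc j) Pj))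

module ExponentVectors where
  open import Data.Nat using (_+_; _*_)
  open import Algebra.Properties.CommutativeSemigroup ℕₚ.+-commutativeSemigroup using (interchange)

  infixr 6 _⊕_
  _⊕_ : ∀ {n} → Vec ℕ n → Vec ℕ n → Vec ℕ n
  _⊕_ = zipWith _+_

  𝟎 : ∀ {n} → Vec ℕ n
  𝟎 = replicate _ 0

  ⊕-comm : ∀ {n} (u v : Vec ℕ n) → u ⊕ v ≡ v ⊕ u
  ⊕-comm u v = Pointwise-≡⇒≡ (zipWith-comm ℕₚ.+-comm u v)

  ⊕-assoc : ∀ {n} (u v w : Vec ℕ n) → (u ⊕ v) ⊕ w ≡ u ⊕ (v ⊕ w)
  ⊕-assoc u v w = Pointwise-≡⇒≡ (zipWith-assoc ℕₚ.+-assoc u v w)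

  ⊕-identityˡ : ∀ {n} (u : Vec ℕ n) → 𝟎 ⊕ u ≡ u
  ⊕-identityˡ u = Pointwise-≡⇒≡ (zipWith-identityˡ ℕₚ.+-identityˡ u)

  ⊕-swap : ∀ {n} (u v w : Vec ℕ n) → u ⊕ (v ⊕ w) ≡ v ⊕ (u ⊕ w)
  ⊕-swap u v w = begin
    u ⊕ (v ⊕ w)  ≡⟨ ⊕-assoc u v w ⟨
    (u ⊕ v) ⊕ w  ≡⟨ cong (_⊕ w) (⊕-comm u v) ⟩
    (v ⊕ u) ⊕ w  ≡⟨ ⊕-assoc v u w ⟩
    v ⊕ (u ⊕ w)  ∎
    where open ≡-Reasoning

  ⊕-cancelˡ : ∀ {n} (u : Vec ℕ n) {v w} → u ⊕ v ≡ u ⊕ w → v ≡ w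
  ⊕-cancelˡ []      {[]}    {[]}    _  = refl
  ⊕-cancelˡ (x ∷ u) {y ∷ v} {z ∷ w} eq =
    cong₂ _∷_ (ℕₚ.+-cancelˡ-≡ x y z (Vecₚ.∷-injectiveˡ eq)) (⊕-cancelˡ u (Vecₚ.∷-injectiveʳ eq))

  ⊕-tabulate : ∀ {n} (f g : Fin n → ℕ) → tabulate f ⊕ tabulate g ≡ tabulate (λ i → f i + g i)
  ⊕-tabulate {ℕ.zero}  f g = refl
  ⊕-tabulate {ℕ.suc n} f g = cong (f zero + g zero ∷_) (⊕-tabulate (f ∘ suc) (g ∘ suc))

  lookup-⊕ : ∀ {n} (u v : Vec ℕ n) i → lookup (u ⊕ v) i ≡ lookup u i + lookup v i
  lookup-⊕ u v i = Vecₚ.lookup-zipWith _+_ i u v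

  unit : ∀ {n} → Fin n → Vec ℕ n
  unit i = tabulate (λ j → if ⌊ i Finₚ.≟ j ⌋ then 1 else 0)

  unit-zero : ∀ {n} → unit {ℕ.suc n} zero ≡ 1 ∷ 𝟎
  unit-zero = cong (1 ∷_) (trans (Vecₚ.tabulate-cong (λ i → sym (Vecₚ.lookup-replicate i 0))) (Vecₚ.tabulate∘lookup 𝟎))

  unit-suc : ∀ {n} (a : Fin n) → unit (suc a) ≡ 0 ∷ unit a
  unit-suc a = cong (0 ∷_) (Vecₚ.tabulate-cong λ j → cong (if_then 1 else 0) (⌊suc≟suc⌋ j))
    where
    ⌊suc≟suc⌋ : ∀ j → ⌊ suc a Finₚ.≟ suc j ⌋ ≡ ⌊ a Finₚ.≟ j ⌋
    ⌊suc≟suc⌋ j with a Finₚ.≟ j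
    ... | yes _ = refl
    ... | no  _ = refl

  exponent : ∀ {n} → List (Fin n) → Vec ℕ n
  exponent []      = 𝟎
  exponent (a ∷ l) = unit a ⊕ exponent l

  exponent-map-suc : ∀ {n} (l : List (Fin n)) → exponent (map suc l) ≡ 0 ∷ exponent l
  exponent-map-suc []      = refl
  exponent-map-suc (a ∷ l) = cong₂ _⊕_ (unit-suc a) (exponent-map-suc l)

  exponent-surjective : ∀ {n} (u : Vec ℕ n) → ∃ λ l → exponent l ≡ u
  exponent-surjective []      = [] , refl
  exponent-surjective (x ∷ u) = go x
    where
    go : ∀ x → ∃ λ l → exponent l ≡ x ∷ u
    go ℕ.zero    = let l , eq = exponent-surjective u in
                   map suc l , trans (exponent-map-suc l) (cong (0 ∷_) eq)
    go (ℕ.suc x) = let l , eq = go x in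
                   zero ∷ l , trans (cong₂ _⊕_ unit-zero eq) (cong (ℕ.suc x ∷_) (⊕-identityˡ u))

  sum-map-+ : ∀ {A : Set} (f g : A → ℕ) xs → sum (map (λ x → f x + g x) xs) ≡ sum (map f xs) + sum (map g xs)
  sum-map-+ f g []       = refl
  sum-map-+ f g (x ∷ xs) = trans (cong (f x + g x +_) (sum-map-+ f g xs)) (interchange (f x) (g x) _ _)

  sum-tabulate-unit : ∀ {n} (a : Fin n) (g : Fin n → ℕ) → sum (List.tabulate (λ b → lookup (unit a) b * g b)) ≡ g a
  sum-tabulate-unit {ℕ.suc n} zero g = begin
    1 * g zero + sum (List.tabulate (λ b → lookup (unit zero) (suc b) * g (suc b)))
      ≡⟨ cong (λ s → 1 * g zero + sum s) (Listₚ.tabulate-cong λ b → cong (_* g (suc b)) (lookup-unit-zero b)) ⟩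
    1 * g zero + sum (List.tabulate {n = n} (λ _ → 0))
      ≡⟨ cong (1 * g zero +_) (sum-tabulate-0 n) ⟩
    1 * g zero + 0
      ≡⟨ ℕₚ.+-identityʳ _ ⟩
    1 * g zero
      ≡⟨ ℕₚ.*-identityˡ _ ⟩
    g zero ∎
    where
    open ≡-Reasoning
    lookup-unit-zero : ∀ b → lookup (unit zero) (suc b) ≡ 0
    lookup-unit-zero b = trans (cong (λ v → lookup v (suc b)) unit-zero) (Vecₚ.lookup-replicate b 0)
    sum-tabulate-0 : ∀ n → sum (List.tabulate {n = n} (λ _ → 0)) ≡ 0
    sum-tabulate-0 ℕ.zero    = refl
    sum-tabulate-0 (ℕ.suc n) = sum-tabulate-0 n
  sum-tabulate-unit {ℕ.suc n} (suc a) g =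
    trans (cong sum (Listₚ.tabulate-cong λ b → cong (λ v → lookup v (suc b) * g (suc b)) (unit-suc a)))
          (sum-tabulate-unit a (g ∘ suc))

  sum-map-allFin-unit : ∀ {n} (a : Fin n) (g : Fin n → ℕ) → sum (map (λ b → lookup (unit a) b * g b) (allFin n)) ≡ g a
  sum-map-allFin-unit {n} a g =
    trans (cong sum (Listₚ.map-tabulate {n = n} (λ b → b) (λ b → lookup (unit a) b * g b))) (sum-tabulate-unit a g)

open ExponentVectors

module FinDistLatticeProperties (L : FinDistLattice) where
  open LatticeNotions L
  open LS.IsDistributiveLattice isDistributiveLattice
    using (isLattice; ∨-assoc; ∧-comm; ∧-assoc; ∨-absorbs-∧; ∧-absorbs-∨; ∧-distribˡ-∨)
  open LS.IsDistributiveLattice isDistributiveLattice public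
    using () renaming (∨-comm to ⊔-comm)

  lattice : Lattice 0ℓ 0ℓ
  lattice = record { Carrier = Elt; _≈_ = _≡_; _∨_ = _⊔ᴸ_; _∧_ = _⊓ᴸ_; isLattice = isLattice }

  open import Algebra.Lattice.Properties.Lattice lattice using (∨-idem; ∧-idem)
  open ≡-Reasoning

  ≤-refl : ∀ {a} → a ≤ a
  ≤-refl {a} = ∨-idem a

  ≤-trans : ∀ {a b c} → a ≤ b → b ≤ c → a ≤ c
  ≤-trans {a} {b} {c} a≤b b≤c = begin
    a ⊔ᴸ c          ≡⟨ cong (a ⊔ᴸ_) b≤c ⟨
    a ⊔ᴸ (b ⊔ᴸ c)   ≡⟨ ∨-assoc a b c ⟨
    (a ⊔ᴸ b) ⊔ᴸ c   ≡⟨ cong (_⊔ᴸ c) a≤b ⟩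
    b ⊔ᴸ c          ≡⟨ b≤c ⟩
    c               ∎

  ≤-antisym : ∀ {a b} → a ≤ b → b ≤ a → a ≡ b
  ≤-antisym {a} {b} a≤b b≤a = trans (sym b≤a) (trans (⊔-comm b a) a≤b)

  ≤-isPartialOrder : IsPartialOrder _≡_ _≤_
  ≤-isPartialOrder = record
    { isPreorder = record
      { isEquivalence = ≡.isEquivalence
      ; reflexive     = λ { refl → ≤-refl }
      ; trans         = ≤-trans
      }
    ; antisym = ≤-antisym
    }

  _≤?_ : Decidable _≤_
  a ≤? b = (a ⊔ᴸ b) Finₚ.≟ b

  x≤x⊔y : ∀ {a b} → a ≤ (a ⊔ᴸ b)
  x≤x⊔y {a} {b} = trans (sym (∨-assoc a a b)) (cong (_⊔ᴸ b) ≤-refl)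

  y≤x⊔y : ∀ {a b} → b ≤ (a ⊔ᴸ b)
  y≤x⊔y {a} {b} = subst (b ≤_) (⊔-comm b a) x≤x⊔y

  ⊔-least : ∀ {a b c} → a ≤ c → b ≤ c → (a ⊔ᴸ b) ≤ c
  ⊔-least {a} {b} {c} a≤c b≤c = trans (∨-assoc a b c) (trans (cong (a ⊔ᴸ_) b≤c) a≤c)

  ≤⇒⊓≡ : ∀ {a b} → a ≤ b → a ⊓ᴸ b ≡ a
  ≤⇒⊓≡ {a} {b} a≤b = trans (cong (a ⊓ᴸ_) (sym a≤b)) (∧-absorbs-∨ a b)

  ⊓≡⇒≤ : ∀ {a b} → a ⊓ᴸ b ≡ a → a ≤ b
  ⊓≡⇒≤ {a} {b} a⊓b≡a = begin
    a ⊔ᴸ b            ≡⟨ cong (_⊔ᴸ b) a⊓b≡a ⟨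
    (a ⊓ᴸ b) ⊔ᴸ b     ≡⟨ ⊔-comm (a ⊓ᴸ b) b ⟩
    b ⊔ᴸ (a ⊓ᴸ b)     ≡⟨ cong (b ⊔ᴸ_) (∧-comm a b) ⟩
    b ⊔ᴸ (b ⊓ᴸ a)     ≡⟨ ∨-absorbs-∧ b a ⟩
    b                 ∎

  x⊓y≤x : ∀ {a b} → (a ⊓ᴸ b) ≤ a
  x⊓y≤x {a} {b} = ⊓≡⇒≤ (trans (∧-comm (a ⊓ᴸ b) a) (trans (sym (∧-assoc a a b)) (cong (_⊓ᴸ b) (∧-idem a))))

  open ToStrict _≡_ _≤_ public using (_<_; <⇒≤; <-irrefl)

  <-≤-trans : ∀ {a b c} → a < b → b ≤ c → a < c
  <-≤-trans = ToStrict.<-≤-trans _≡_ _≤_ sym ≤-trans ≤-antisym (IsPartialOrder.≤-respʳ-≈ ≤-isPartialOrder)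

  _<?_ : Decidable _<_
  _<?_ = ToStrict.<-decidable _≡_ _≤_ Finₚ._≟_ _≤?_

  <-wellFounded : WellFounded _<_
  <-wellFounded = spo-wellFounded (ToStrict.<-isStrictPartialOrder _≡_ _≤_ ≤-isPartialOrder)

  >-wellFounded : WellFounded (flip _<_)
  >-wellFounded = spo-wellFounded (Flip.isStrictPartialOrder (ToStrict.<-isStrictPartialOrder _≡_ _≤_ ≤-isPartialOrder))

  module _ {p} {P : Elt → Set p} (P? : U.Decidable P) where

    maximal-above : ∀ {x} → P x → ∃ λ y → x ≤ y × P y × ∀ {z} → P z → ¬ y < z
    maximal-above {x} Px = go (>-wellFounded x) ≤-refl Px
      where
      go : ∀ {y} → Acc (flip _<_) y → x ≤ y → P y → ∃ λ y → x ≤ y × P y × ∀ {z} → P z → ¬ y < z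
      go {y} (acc rec) x≤y Py with Finₚ.any? (λ z → P? z ×-dec (y <? z))
      ... | yes (z , Pz , y<z) = go (rec y<z) (≤-trans x≤y (<⇒≤ y<z)) Pz
      ... | no  ∄z             = y , x≤y , Py , λ Pz y<z → ∄z (_ , Pz , y<z)

    minimal-below : ∀ {x} → P x → ∃ λ y → y ≤ x × P y × ∀ {z} → P z → ¬ z < y
    minimal-below {x} Px = go (<-wellFounded x) ≤-refl Px
      where
      go : ∀ {y} → Acc _<_ y → y ≤ x → P y → ∃ λ y → y ≤ x × P y × ∀ {z} → P z → ¬ z < y
      go {y} (acc rec) y≤x Py with Finₚ.any? (λ z → P? z ×-dec (z <? y))
      ... | yes (z , Pz , z<y) = go (rec z<y) (≤-trans (<⇒≤ z<y) y≤x) Pz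
      ... | no  ∄z             = y , y≤x , Py , λ Pz z<y → ∄z (_ , Pz , z<y)

  T-≤ᵇ⇔ : ∀ {a b} → T (a ≤ᵇ b) ⇔ a ≤ b
  T-≤ᵇ⇔ = mk⇔ toWitness fromWitness

  T-<ᵇ⇔ : ∀ {a b} → T (a <ᵇ b) ⇔ a < b
  T-<ᵇ⇔ {a} {b} = mk⇔
    (λ h → let a≤ᵇb , a≢ᵇb = to (T-∧ {a ≤ᵇ b}) h in toWitness a≤ᵇb , to T-not⇔¬T a≢ᵇb ∘ fromWitness)
    (λ (a≤b , a≢b) → from (T-∧ {a ≤ᵇ b}) (fromWitness a≤b , from T-not⇔¬T (a≢b ∘ toWitness)))

  _⋖_ : Elt → Elt → Set
  c ⋖ p = c < p × ∀ {r} → c < r → ¬ r < p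

  T-covers⇔ : ∀ {p c} → T (covers p c) ⇔ c ⋖ p
  T-covers⇔ {p} {c} = mk⇔
    (λ h → let c<ᵇp , none = to (T-∧ {c <ᵇ p}) h in
      to T-<ᵇ⇔ c<ᵇp , λ {r} c<r r<p → to (T-none⇔ _) none r (from (T-∧ {c <ᵇ r}) (from T-<ᵇ⇔ c<r , from T-<ᵇ⇔ r<p)))
    (λ (c<p , noneBetween) → from (T-∧ {c <ᵇ p}) (from T-<ᵇ⇔ c<p , from (T-none⇔ _) λ r h →
      let c<ᵇr , r<ᵇp = to (T-∧ {c <ᵇ r}) h in noneBetween (to T-<ᵇ⇔ c<ᵇr) (to T-<ᵇ⇔ r<ᵇp)))

  JoinIrreducible : Elt → Set
  JoinIrreducible p = ∃ λ c → c ⋖ p × ∀ {z} → z ⋖ p → z ≡ c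

  T-isJI⇔ : ∀ {p} → T (isJI p) ⇔ JoinIrreducible p
  T-isJI⇔ {p} = mk⇔
    (λ h → let c , c⋖p , unique = to (length-filterᵇ-tabulate≡1⇔ (covers p) (λ x → x)) (toWitness h) in
      c , to T-covers⇔ c⋖p , λ {z} z⋖p → unique z (from T-covers⇔ z⋖p))
    (λ (c , c⋖p , unique) → fromWitness (from (length-filterᵇ-tabulate≡1⇔ (covers p) (λ x → x))
      (c , from T-covers⇔ c⋖p , λ z z⋖p → unique (to T-covers⇔ z⋖p))))

  x⊓y≤y : ∀ {a b} → (a ⊓ᴸ b) ≤ b
  x⊓y≤y {a} {b} = subst (_≤ b) (∧-comm b a) x⊓y≤x

  x⊓y<x : ∀ {a b} → ¬ a ≤ b → (a ⊓ᴸ b) < a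
  x⊓y<x a≰b = x⊓y≤x , a≰b ∘ ⊓≡⇒≤

  lower-cover-above : ∀ {z p} → z < p → ∃ λ c → z ≤ c × c ⋖ p
  lower-cover-above {p = p} z<p with maximal-above (_<? p) z<p
  ... | c , z≤c , c<p , maximal = c , z≤c , c<p , λ c<r r<p → maximal r<p c<r

  ⊔-of-distinct-lower-covers : ∀ {c₁ c₂ p} → c₁ ⋖ p → c₂ ⋖ p → c₁ ≢ c₂ → (c₁ ⊔ᴸ c₂) ≡ p
  ⊔-of-distinct-lower-covers {c₁} {c₂} {p} (c₁<p , c₁-cover) (c₂<p , c₂-cover) c₁≢c₂
    with (c₁ ⊔ᴸ c₂) Finₚ.≟ p | c₁ Finₚ.≟ (c₁ ⊔ᴸ c₂)
  ... | yes c₁⊔c₂≡p | _  = c₁⊔c₂≡p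
  ... | no c₁⊔c₂≢p | yes c₁≡c₁⊔c₂ =
    contradiction c₁<p (c₂-cover (subst (c₂ ≤_) (sym c₁≡c₁⊔c₂) y≤x⊔y , c₁≢c₂ ∘ sym))
  ... | no c₁⊔c₂≢p | no c₁≢c₁⊔c₂ =
    contradiction (⊔-least (<⇒≤ c₁<p) (<⇒≤ c₂<p) , c₁⊔c₂≢p) (c₁-cover (x≤x⊔y , c₁≢c₁⊔c₂))

  below-lower-cover : ∀ {p} ((c , _) : JoinIrreducible p) → ∀ {z} → z < p → z ≤ c
  below-lower-cover (c , _ , unique) z<p with lower-cover-above z<p
  ... | c′ , z≤c′ , c′⋖p = subst (_ ≤_) (unique c′⋖p) z≤c′

  JI-≰-lower-cover : ∀ {p} ((c , _) : JoinIrreducible p) → ¬ p ≤ c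
  JI-≰-lower-cover (c , (c<p , _) , _) p≤c = <-irrefl refl (<-≤-trans c<p p≤c)

  -- p ⊓ a and p ⊓ b lie strictly below p, hence below its unique lower cover, yet they join to p.
  join-prime : ∀ {p a b} → JoinIrreducible p → p ≤ (a ⊔ᴸ b) → p ≤ a ⊎ p ≤ b
  join-prime {p} {a} {b} p-JI p≤a⊔b with p ≤? a | p ≤? b
  ... | yes p≤a | _       = inj₁ p≤a
  ... | no _    | yes p≤b = inj₂ p≤b
  ... | no p≰a  | no p≰b  = contradiction p≤c (JI-≰-lower-cover p-JI)
    where
    p≡[p⊓a]⊔[p⊓b] : p ≡ (p ⊓ᴸ a) ⊔ᴸ (p ⊓ᴸ b)
    p≡[p⊓a]⊔[p⊓b] = trans (sym (≤⇒⊓≡ p≤a⊔b)) (∧-distribˡ-∨ p a b)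
    p≤c : p ≤ proj₁ p-JI
    p≤c = subst (_≤ proj₁ p-JI) (sym p≡[p⊓a]⊔[p⊓b])
            (⊔-least (below-lower-cover p-JI (x⊓y<x p≰a)) (below-lower-cover p-JI (x⊓y<x p≰b)))

  -- The carrier Fin size may be empty, so the least element is computed from a given one.
  ⊥ᴸ : Elt → Elt
  ⊥ᴸ x = foldr _⊓ᴸ_ x elts

  ⊥ᴸ-least : ∀ x z → ⊥ᴸ x ≤ z
  ⊥ᴸ-least x z = go (∈-allFin z)
    where
    go : ∀ {xs} → z ∈ xs → foldr _⊓ᴸ_ x xs ≤ z
    go (here refl) = x⊓y≤x
    go (there z∈xs) = ≤-trans x⊓y≤y (go z∈xs)

  JI-≰-⊥ᴸ : ∀ {p} → JoinIrreducible p → ∀ x → ¬ p ≤ ⊥ᴸ x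
  JI-≰-⊥ᴸ p-JI x p≤⊥ = JI-≰-lower-cover p-JI (≤-trans p≤⊥ (⊥ᴸ-least x _))

  JI-≤-⊔⇔ : ∀ {p a b} → JoinIrreducible p → p ≤ (a ⊔ᴸ b) ⇔ (p ≤ a ⊎ p ≤ b)
  JI-≤-⊔⇔ p-JI = mk⇔ (join-prime p-JI) [ (λ p≤a → ≤-trans p≤a x≤x⊔y) , (λ p≤b → ≤-trans p≤b y≤x⊔y) ]′

  JI-≤-foldl-⊔⇔ : ∀ {p} → JoinIrreducible p → ∀ s xs → p ≤ foldl _⊔ᴸ_ s xs ⇔ Any (p ≤_) (s ∷ xs)
  JI-≤-foldl-⊔⇔ p-JI s []       = mk⇔ here λ { (here p≤s) → p≤s ; (there ()) }
  JI-≤-foldl-⊔⇔ p-JI s (x ∷ xs) = mk⇔ (split ∘ to ih) (from ih ∘ merge)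
    where
    ih = JI-≤-foldl-⊔⇔ p-JI (s ⊔ᴸ x) xs
    split : Any (_ ≤_) ((s ⊔ᴸ x) ∷ xs) → Any (_ ≤_) (s ∷ x ∷ xs)
    split (here p≤s⊔x) = [ here , there ∘ here ]′ (to (JI-≤-⊔⇔ p-JI) p≤s⊔x)
    split (there p≤xs) = there (there p≤xs)
    merge : Any (_ ≤_) (s ∷ x ∷ xs) → Any (_ ≤_) ((s ⊔ᴸ x) ∷ xs)
    merge (here p≤s)          = here (from (JI-≤-⊔⇔ p-JI) (inj₁ p≤s))
    merge (there (here p≤x))  = here (from (JI-≤-⊔⇔ p-JI) (inj₂ p≤x))
    merge (there (there p≤xs)) = there p≤xs

  -- A minimal m ≤ x with m ≰ y is join-irreducible: its lower covers lie below y, two distinct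
  -- ones would join to m, and one exists above m ⊓ y < m.
  ≤-by-JI : ∀ {x y} → (∀ {p} → JoinIrreducible p → p ≤ x → p ≤ y) → x ≤ y
  ≤-by-JI {x} {y} below with x ≤? y
  ... | yes x≤y = x≤y
  ... | no x≰y with minimal-below (λ w → (w ≤? x) ×-dec ¬? (w ≤? y)) (≤-refl , x≰y)
  ...   | m , _ , (m≤x , m≰y) , minimal = contradiction (below m-JI m≤x) m≰y
    where
    lower-covers-≤y : ∀ {c} → c ⋖ m → c ≤ y
    lower-covers-≤y {c} (c<m , _) with c ≤? y
    ... | yes c≤y = c≤y
    ... | no c≰y  = contradiction c<m (minimal (≤-trans (<⇒≤ c<m) m≤x , c≰y))
    m-JI : JoinIrreducible m
    m-JI with lower-cover-above (x⊓y<x m≰y)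
    ... | c , _ , c⋖m = c , c⋖m , λ {z} z⋖m → decidable-stable (z Finₚ.≟ c) λ z≢c →
      m≰y (subst (_≤ y) (⊔-of-distinct-lower-covers z⋖m c⋖m z≢c)
                         (⊔-least (lower-covers-≤y z⋖m) (lower-covers-≤y c⋖m)))

  ≡-by-JI : ∀ {x y} → (∀ {p} → JoinIrreducible p → p ≤ x ⇔ p ≤ y) → x ≡ y
  ≡-by-JI same = ≤-antisym (≤-by-JI (to ∘ same)) (≤-by-JI (from ∘ same))

module Odot (L : FinDistLattice) (open? : Fin (FinDistLattice.size L) → Bool) where
  open LatticeNotions L
  open WithPartition open?
  open FinDistLatticeProperties L

  -- inK a p unfolds to  isJI p ∧ (p ≤ᵇ a) ∧ (open? p ∨ maximalᵇ a p).
  maximalᵇ : Elt → Elt → Bool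
  maximalᵇ a p = not (any (λ q → isJI q ∧ (q ≤ᵇ a) ∧ (p <ᵇ q)) elts)

  MaximalIn : Elt → Elt → Set
  MaximalIn a p = ∀ {q} → JoinIrreducible q → q ≤ a → ¬ p < q

  T-maximalᵇ⇔ : ∀ {a p} → T (maximalᵇ a p) ⇔ MaximalIn a p
  T-maximalᵇ⇔ {a} {p} = mk⇔
    (λ h {q} q-JI q≤a p<q → to (T-none⇔ _) h q
       (from (T-∧ {isJI q}) (from T-isJI⇔ q-JI , from (T-∧ {q ≤ᵇ a}) (from T-≤ᵇ⇔ q≤a , from T-<ᵇ⇔ p<q))))
    (λ maximal → from (T-none⇔ _) λ q h →
       let q-JI , rest = to (T-∧ {isJI q}) h
           q≤ᵇa , p<ᵇq = to (T-∧ {q ≤ᵇ a}) rest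
       in maximal (to T-isJI⇔ q-JI) (to T-≤ᵇ⇔ q≤ᵇa) (to T-<ᵇ⇔ p<ᵇq))

  ≰⇒MaximalIn : ∀ {a p} → ¬ p ≤ a → MaximalIn a p
  ≰⇒MaximalIn p≰a _ q≤a p<q = p≰a (≤-trans (<⇒≤ p<q) q≤a)

  ≤ᵇ-⊔ : ∀ {p} a b → JoinIrreducible p → (p ≤ᵇ (a ⊔ᴸ b)) ≡ (p ≤ᵇ a) ∨ (p ≤ᵇ b)
  ≤ᵇ-⊔ {p} a b p-JI = T⇔T⇒≡ (mk⇔
    (from (T-∨ {p ≤ᵇ a}) ∘ Data.Sum.map (from T-≤ᵇ⇔) (from T-≤ᵇ⇔) ∘ to (JI-≤-⊔⇔ p-JI) ∘ to T-≤ᵇ⇔)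
    (from T-≤ᵇ⇔ ∘ from (JI-≤-⊔⇔ p-JI) ∘ Data.Sum.map (to T-≤ᵇ⇔) (to T-≤ᵇ⇔) ∘ to (T-∨ {p ≤ᵇ a})))

  maximalᵇ-⊔ : ∀ a b p → maximalᵇ (a ⊔ᴸ b) p ≡ maximalᵇ a p ∧ maximalᵇ b p
  maximalᵇ-⊔ a b p = T⇔T⇒≡ (mk⇔
    (λ h → let maximal = to T-maximalᵇ⇔ h in
      from (T-∧ {maximalᵇ a p}) (from T-maximalᵇ⇔ (λ q-JI q≤a → maximal q-JI (≤-trans q≤a x≤x⊔y)) ,
                                  from T-maximalᵇ⇔ (λ q-JI q≤b → maximal q-JI (≤-trans q≤b y≤x⊔y))))
    (λ h → let maxa , maxb = to (T-∧ {maximalᵇ a p}) h in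
      from T-maximalᵇ⇔ λ q-JI q≤a⊔b →
        [ to T-maximalᵇ⇔ maxa q-JI , to T-maximalᵇ⇔ maxb q-JI ]′ (join-prime q-JI q≤a⊔b)))

  ≤ᵇ∨maximalᵇ : ∀ a p → T ((p ≤ᵇ a) ∨ maximalᵇ a p)
  ≤ᵇ∨maximalᵇ a p =
    from (T-∨ {p ≤ᵇ a}) (Data.Sum.map (from T-≤ᵇ⇔) (from T-maximalᵇ⇔ ∘ ≰⇒MaximalIn) (toSum (p ≤? a)))

  InK : Elt → Elt → Set
  InK a p = JoinIrreducible p × p ≤ a × (T (open? p) ⊎ MaximalIn a p)

  T-inK⇔ : ∀ a p → T (inK a p) ⇔ InK a p
  T-inK⇔ a p = mk⇔
    (Product.map (to T-isJI⇔) (Product.map (to T-≤ᵇ⇔) (Data.Sum.map₂ (to T-maximalᵇ⇔))) ∘ to parts)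
    (from parts ∘ Product.map (from T-isJI⇔) (Product.map (from T-≤ᵇ⇔) (Data.Sum.map₂ (from T-maximalᵇ⇔))))
    where parts = T-∧∧∨⇔ (isJI p) (p ≤ᵇ a) (open? p) (maximalᵇ a p)

  shared : Elt → Elt → Elt → Bool
  shared a b q = isJI q ∧ ((q ≤ᵇ a) ∧ (q ≤ᵇ b)) ∧ (open? q ∨ maximalᵇ a q ∨ maximalᵇ b q)

  Shared : Elt → Elt → Elt → Set
  Shared a b q = JoinIrreducible q × (q ≤ a × q ≤ b) × (T (open? q) ⊎ MaximalIn a q ⊎ MaximalIn b q)

  T-shared⇔ : ∀ a b q → T (shared a b q) ⇔ Shared a b q
  T-shared⇔ a b q = mk⇔
    (Product.map (to T-isJI⇔) (Product.map (Product.map (to T-≤ᵇ⇔) (to T-≤ᵇ⇔) ∘ to T-∧)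
                               (Data.Sum.map₂ (Data.Sum.map (to T-maximalᵇ⇔) (to T-maximalᵇ⇔) ∘ to T-∨))) ∘ to parts)
    (from parts ∘ Product.map (from T-isJI⇔) (Product.map (from T-∧ ∘ Product.map (from T-≤ᵇ⇔) (from T-≤ᵇ⇔))
                               (Data.Sum.map₂ (from T-∨ ∘ Data.Sum.map (from T-maximalᵇ⇔) (from T-maximalᵇ⇔)))))
    where parts = T-∧∧∨⇔ (isJI q) ((q ≤ᵇ a) ∧ (q ≤ᵇ b)) (open? q) (maximalᵇ a q ∨ maximalᵇ b q)

  _⊙_ : Elt → Elt → Elt
  a ⊙ b = foldl _⊔ᴸ_ (⊥ᴸ a) (filterᵇ (shared a b) elts)

  Shared⇒≤⊙ : ∀ {a b q} → Shared a b q → q ≤ (a ⊙ b)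
  Shared⇒≤⊙ {a} {b} {q} q-shared@(q-JI , _) = from (JI-≤-foldl-⊔⇔ q-JI (⊥ᴸ a) (filterᵇ (shared a b) elts))
    (there (lose (∈-filter⁺ (T? ∘ shared a b) (∈-allFin q) (from (T-shared⇔ a b q) q-shared)) ≤-refl))

  ≤⊙⇒≤-Shared : ∀ {a b p} → JoinIrreducible p → p ≤ (a ⊙ b) → ∃ λ q → Shared a b q × p ≤ q
  ≤⊙⇒≤-Shared {a} {b} p-JI p≤a⊙b = below-some (to (JI-≤-foldl-⊔⇔ p-JI (⊥ᴸ a) (filterᵇ (shared a b) elts)) p≤a⊙b)
    where
    below-some : Any (_ ≤_) (⊥ᴸ a ∷ filterᵇ (shared a b) elts) → ∃ λ q → Shared a b q × _ ≤ q
    below-some (here p≤⊥)     = contradiction p≤⊥ (JI-≰-⊥ᴸ p-JI a)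
    below-some (there p≤some) = let q , q∈ , p≤q = find p≤some in
      q , to (T-shared⇔ a b q) (proj₂ (∈-filter⁻ (T? ∘ shared a b) {xs = elts} q∈)) , p≤q

  MaximalIn-⊙ : ∀ {a b p} → MaximalIn a p ⊎ MaximalIn b p → MaximalIn (a ⊙ b) p
  MaximalIn-⊙ maximal r-JI r≤a⊙b p<r =
    let _ , (_ , (q≤a , q≤b) , _) , r≤q = ≤⊙⇒≤-Shared r-JI r≤a⊙b in
    [ (λ maxa → maxa r-JI (≤-trans r≤q q≤a) p<r) , (λ maxb → maxb r-JI (≤-trans r≤q q≤b) p<r) ]′ maximal

  InK-⊙⇔Shared : ∀ {a b p} → InK (a ⊙ b) p ⇔ Shared a b p
  InK-⊙⇔Shared {a} {b} {p} = mk⇔ sound complete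
    where
    sound : InK (a ⊙ b) p → Shared a b p
    sound (p-JI , p≤a⊙b , kind) =
      let q , q-shared@(_ , (q≤a , q≤b) , _) , p≤q = ≤⊙⇒≤-Shared p-JI p≤a⊙b in
      [ (λ p-open → p-JI , (≤-trans p≤q q≤a , ≤-trans p≤q q≤b) , inj₁ p-open)
      , (λ maximal → subst (Shared a b)
            (decidable-stable (q Finₚ.≟ p) λ q≢p → maximal (proj₁ q-shared) (Shared⇒≤⊙ q-shared) (p≤q , q≢p ∘ sym))
            q-shared)
      ]′ kind
    complete : Shared a b p → InK (a ⊙ b) p
    complete p-shared@(p-JI , _ , kind) = p-JI , Shared⇒≤⊙ p-shared , Data.Sum.map₂ MaximalIn-⊙ kind

  maximal-JI-above : ∀ {p a} → JoinIrreducible p → p ≤ a → ∃ λ q → p ≤ q × InK a q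
  maximal-JI-above p-JI p≤a with maximal-above (λ r → T? (isJI r) ×-dec (r ≤? _)) (from T-isJI⇔ p-JI , p≤a)
  ... | q , p≤q , (q-JI , q≤a) , maximal =
    q , p≤q , to T-isJI⇔ q-JI , q≤a , inj₂ λ r-JI r≤a q<r → maximal (from T-isJI⇔ r-JI , r≤a) q<r

  inK-⊙ : ∀ a b p → inK (a ⊙ b) p ≡ shared a b p
  inK-⊙ a b p = T⇔T⇒≡ {inK (a ⊙ b) p} {shared a b p}
    (mk⇔ (from (T-shared⇔ a b p) ∘ to (InK-⊙⇔Shared {a} {b} {p}) ∘ to (T-inK⇔ (a ⊙ b) p))
         (from (T-inK⇔ (a ⊙ b) p) ∘ from (InK-⊙⇔Shared {a} {b} {p}) ∘ to (T-shared⇔ a b p)))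

  -- At a join-irreducible p: o = [p ∈ U_o], A = [p ≤ a], MA = [no join-irreducible of ι(a) lies strictly
  -- above p], and likewise for b.
  indicator-identity : ∀ o A B MA MB → T (A ∨ MA) → T (B ∨ MB) →
    𝟏 (A ∧ (o ∨ MA)) ℕ.+ 𝟏 (B ∧ (o ∨ MB))
      ≡ 𝟏 ((A ∨ B) ∧ (o ∨ MA ∧ MB)) ℕ.+ 𝟏 ((A ∧ B) ∧ (o ∨ MA ∨ MB))
  indicator-identity true  true  true  _     _     _ _  = refl
  indicator-identity true  true  false _     _     _ _  = refl
  indicator-identity true  false true  _     _     _ _  = refl
  indicator-identity true  false false _     _     _ _  = refl
  indicator-identity false true  true  true  true  _ _  = refl
  indicator-identity false true  true  true  false _ _  = refl
  indicator-identity false true  true  false _     _ _  = refl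
  indicator-identity false true  false true  true  _ _  = refl
  indicator-identity false true  false false true  _ _  = refl
  indicator-identity false true  false _     false _ ()
  indicator-identity false false true  true  true  _ _  = refl
  indicator-identity false false true  true  false _ _  = refl
  indicator-identity false false true  false _     () _
  indicator-identity false false false _     _     _ _  = refl

  inK-of-JI : ∀ {a p} → isJI p ≡ true → inK a p ≡ (p ≤ᵇ a) ∧ (open? p ∨ maximalᵇ a p)
  inK-of-JI {a} {p} isJI-p = cong (_∧ ((p ≤ᵇ a) ∧ (open? p ∨ maximalᵇ a p))) isJI-p

  inK-of-nonJI : ∀ {a p} → isJI p ≡ false → inK a p ≡ false
  inK-of-nonJI {a} {p} nonJI-p = cong (_∧ ((p ≤ᵇ a) ∧ (open? p ∨ maximalᵇ a p))) nonJI-p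

  IsOdot⇒indicator-sum : ∀ {a b d} → IsOdot a b d →
    ∀ p → 𝟏 (inK a p) ℕ.+ 𝟏 (inK b p) ≡ 𝟏 (inK (a ⊔ᴸ b) p) ℕ.+ 𝟏 (inK d p)
  IsOdot⇒indicator-sum {a} {b} {d} odot p with isJI p Boolₚ.≟ true
  ... | yes isJI-p = odot p isJI-p
  ... | no  ¬isJI-p = trans (vanish a b) (sym (vanish (a ⊔ᴸ b) d))
    where
    vanish : ∀ x y → 𝟏 (inK x p) ℕ.+ 𝟏 (inK y p) ≡ 0
    vanish x y = cong₂ (λ u v → 𝟏 u ℕ.+ 𝟏 v) (inK-of-nonJI (Boolₚ.¬-not ¬isJI-p)) (inK-of-nonJI (Boolₚ.¬-not ¬isJI-p))

  ⊙-isOdot : ∀ a b → IsOdot a b (a ⊙ b)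
  ⊙-isOdot a b p isJI-p = begin
      𝟏 (inK a p) ℕ.+ 𝟏 (inK b p)
    ≡⟨ cong₂ (λ x y → 𝟏 x ℕ.+ 𝟏 y) (inK-of-JI isJI-p) (inK-of-JI isJI-p) ⟩
      𝟏 (A ∧ (o ∨ MA)) ℕ.+ 𝟏 (B ∧ (o ∨ MB))
    ≡⟨ indicator-identity o A B MA MB (≤ᵇ∨maximalᵇ a p) (≤ᵇ∨maximalᵇ b p) ⟩
      𝟏 ((A ∨ B) ∧ (o ∨ MA ∧ MB)) ℕ.+ 𝟏 ((A ∧ B) ∧ (o ∨ MA ∨ MB))
    ≡⟨ cong₂ (λ x y → 𝟏 x ℕ.+ 𝟏 y) inK-⊔ inK-⊙′ ⟨
      𝟏 (inK (a ⊔ᴸ b) p) ℕ.+ 𝟏 (inK (a ⊙ b) p)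
    ∎
    where
    open ≡-Reasoning
    o = open? p
    A = p ≤ᵇ a
    B = p ≤ᵇ b
    MA = maximalᵇ a p
    MB = maximalᵇ b p
    inK-⊔ : inK (a ⊔ᴸ b) p ≡ (A ∨ B) ∧ (o ∨ MA ∧ MB)
    inK-⊔ = trans (inK-of-JI isJI-p)
                  (cong₂ (λ x y → x ∧ (o ∨ y)) (≤ᵇ-⊔ a b (to T-isJI⇔ (from T-≡ isJI-p))) (maximalᵇ-⊔ a b p))
    inK-⊙′ : inK (a ⊙ b) p ≡ (A ∧ B) ∧ (o ∨ MA ∨ MB)
    inK-⊙′ = trans (inK-⊙ a b p) (cong (_∧ ((A ∧ B) ∧ (o ∨ MA ∨ MB))) isJI-p)

module PolynomialProperties {c ℓ : Level} (R : CommutativeRing c ℓ) where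
  open CommutativeRing R hiding (refl; sym; trans)
  open CommutativeRing R using () renaming (refl to ≈-refl; sym to ≈-sym; trans to ≈-trans)
  open Polynomials R
  open import Algebra.Properties.Ring ring using (-0#≈0#; -‿+-comm)
  open import Algebra.Properties.CommutativeSemigroup +-commutativeSemigroup using (x∙yz≈y∙xz)
  open import Relation.Binary.Reasoning.Setoid setoid

  Term : ℕ → Set c
  Term m = Carrier × Mon m

  private variable
    m k : ℕ

  coeff-++ : ∀ (f g : Poly m) μ → coeff (f ++ g) μ ≈ coeff f μ + coeff g μ
  coeff-++ []            g μ = ≈-sym (+-identityˡ _)
  coeff-++ ((a , ν) ∷ f) g μ with Vecₚ.≡-dec ℕ._≟_ ν μ
  ... | yes _ = ≈-trans (+-congˡ (coeff-++ f g μ)) (≈-sym (+-assoc _ _ _))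
  ... | no  _ = coeff-++ f g μ

  coeff-neg : ∀ (f : Poly m) μ → coeff (-P f) μ ≈ - coeff f μ
  coeff-neg []            μ = ≈-sym -0#≈0#
  coeff-neg ((a , ν) ∷ f) μ with Vecₚ.≡-dec ℕ._≟_ ν μ
  ... | yes _ = ≈-trans (+-congˡ (coeff-neg f μ)) (-‿+-comm a (coeff f μ))
  ... | no  _ = coeff-neg f μ

  coeff-scale : ∀ x (f : Poly m) μ → coeff (map (λ t → (x * proj₁ t , proj₂ t)) f) μ ≈ x * coeff f μ
  coeff-scale x []            μ = ≈-sym (zeroʳ x)
  coeff-scale x ((a , ν) ∷ f) μ with Vecₚ.≡-dec ℕ._≟_ ν μ
  ... | yes _ = ≈-trans (+-congˡ (coeff-scale x f μ)) (≈-sym (distribˡ x a (coeff f μ)))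
  ... | no  _ = coeff-scale x f μ

  coeff-single-+ : ∀ x y (ν μ : Mon m) → coeff ((x + y , ν) ∷ []) μ ≈ coeff ((x , ν) ∷ []) μ + coeff ((y , ν) ∷ []) μ
  coeff-single-+ x y ν μ with Vecₚ.≡-dec ℕ._≟_ ν μ
  ... | yes _ = ≈-trans (+-identityʳ _) (≈-sym (+-cong (+-identityʳ x) (+-identityʳ y)))
  ... | no  _ = ≈-sym (+-identityˡ 0#)

  coeff-single-≈0 : ∀ {x} → x ≈ 0# → (ν μ : Mon m) → coeff ((x , ν) ∷ []) μ ≈ 0#
  coeff-single-≈0 x≈0 ν μ with Vecₚ.≡-dec ℕ._≟_ ν μ
  ... | yes _ = ≈-trans (+-identityʳ _) x≈0
  ... | no  _ = ≈-refl

  termwise-≋ : {f g : Poly m} → Pointwise (λ s t → proj₁ s ≈ proj₁ t × proj₂ s ≡ proj₂ t) f g → f ≋ g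
  termwise-≋ [] μ = ≈-refl
  termwise-≋ {f = (a , ν) ∷ f} ((a≈b , ≡.refl) ∷ rest) μ with Vecₚ.≡-dec ℕ._≟_ ν μ
  ... | yes _ = +-cong a≈b (termwise-≋ rest μ)
  ... | no  _ = termwise-≋ rest μ

  Σc : Poly m → Carrier
  Σc = foldr (λ t s → proj₁ t + s) 0#

  coeff-mapMon-all≡ : ∀ (ψ : Mon m → Mon k) {μ} f → All (λ t → ψ (proj₂ t) ≡ μ) f → coeff (mapMon ψ f) μ ≈ Σc f
  coeff-mapMon-all≡ ψ [] [] = ≈-refl
  coeff-mapMon-all≡ ψ {μ} ((a , ν) ∷ f) (ψν≡μ ∷ all≡) with Vecₚ.≡-dec ℕ._≟_ (ψ ν) μ
  ... | yes _      = +-congˡ (coeff-mapMon-all≡ ψ f all≡)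
  ... | no  ψν≢μ   = contradiction ψν≡μ ψν≢μ

  coeff-mapMon-all≢ : ∀ (ψ : Mon m → Mon k) {μ} f → All (λ t → ψ (proj₂ t) ≢ μ) f → coeff (mapMon ψ f) μ ≈ 0#
  coeff-mapMon-all≢ ψ [] [] = ≈-refl
  coeff-mapMon-all≢ ψ {μ} ((a , ν) ∷ f) (ψν≢μ ∷ all≢) with Vecₚ.≡-dec ℕ._≟_ (ψ ν) μ
  ... | yes ψν≡μ = contradiction ψν≡μ ψν≢μ
  ... | no  _    = coeff-mapMon-all≢ ψ f all≢

  coeff-mapMon-filter : ∀ {p} {P : U.Pred (Term m) p} (P? : U.Decidable P) (ψ : Mon m → Mon k) f μ →
    coeff (mapMon ψ f) μ ≈ coeff (mapMon ψ (filter P? f)) μ + coeff (mapMon ψ (filter (∁? P?) f)) μ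
  coeff-mapMon-filter P? ψ [] μ = ≈-sym (+-identityˡ 0#)
  coeff-mapMon-filter P? ψ (t ∷ f) μ with P? t
  ... | yes _ = ≈-trans (coeff-++ (mapMon ψ (t ∷ [])) (mapMon ψ f) μ)
                  (≈-trans (+-congˡ (coeff-mapMon-filter P? ψ f μ))
                  (≈-trans (≈-sym (+-assoc _ _ _))
                         (+-congʳ (≈-sym (coeff-++ (mapMon ψ (t ∷ [])) (mapMon ψ (filter P? f)) μ)))))
  ... | no  _ = ≈-trans (coeff-++ (mapMon ψ (t ∷ [])) (mapMon ψ f) μ)
                  (≈-trans (+-congˡ (coeff-mapMon-filter P? ψ f μ))
                  (≈-trans (x∙yz≈y∙xz _ _ _)
                         (+-congˡ (≈-sym (coeff-++ (mapMon ψ (t ∷ [])) (mapMon ψ (filter (∁? P?) f)) μ)))))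

  coeff-filter : ∀ {p} {P : U.Pred (Term m) p} (P? : U.Decidable P) f μ →
    coeff f μ ≈ coeff (filter P? f) μ + coeff (filter (∁? P?) f) μ
  coeff-filter P? f μ = begin
    coeff f μ                                                    ≡⟨ ≡.cong (λ h → coeff h μ) (Listₚ.map-id f) ⟨
    coeff (mapMon id f) μ                                        ≈⟨ coeff-mapMon-filter P? id f μ ⟩
    coeff (mapMon id (filter P? f)) μ + coeff (mapMon id (filter (∁? P?) f)) μ
      ≡⟨ ≡.cong₂ (λ g h → coeff g μ + coeff h μ) (Listₚ.map-id (filter P? f)) (Listₚ.map-id (filter (∁? P?) f)) ⟩
    coeff (filter P? f) μ + coeff (filter (∁? P?) f) μ           ∎
    where
    id : Mon m → Mon m
    id ν = ν

  module Fibre (κ : Mon m → Mon k) (ν : Mon m) where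

    InFibre : U.Pred (Term m) _
    InFibre t = κ (proj₂ t) ≡ κ ν

    InFibre? : U.Decidable InFibre
    InFibre? t = Vecₚ.≡-dec ℕ._≟_ (κ (proj₂ t)) (κ ν)

    fibre rest : Poly m → Poly m
    fibre = filter InFibre?
    rest  = filter (∁? InFibre?)

    all-fibre : ∀ f → All InFibre (fibre f)
    all-fibre = Allₚ.all-filter InFibre?

    all-rest : ∀ f → All (U.∁ InFibre) (rest f)
    all-rest = Allₚ.all-filter (∁? InFibre?)

    rest-shorter : ∀ a f → length (rest ((a , ν) ∷ f)) ℕ.< length ((a , ν) ∷ f)
    rest-shorter a f = Listₚ.filter-notAll (∁? InFibre?) ((a , ν) ∷ f) (here λ ∉fibre → ∉fibre ≡.refl)

    Σc-fibre≈0 : ∀ f → mapMon κ f ≋ 0P → Σc (fibre f) ≈ 0#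
    Σc-fibre≈0 f ker = begin
      Σc (fibre f)                                                         ≈⟨ +-identityʳ _ ⟨
      Σc (fibre f) + 0#                                                    ≈⟨ +-cong (coeff-mapMon-all≡ κ (fibre f) (all-fibre f))
                                                                                     (coeff-mapMon-all≢ κ (rest f) (all-rest f)) ⟨
      coeff (mapMon κ (fibre f)) (κ ν) + coeff (mapMon κ (rest f)) (κ ν)   ≈⟨ coeff-mapMon-filter InFibre? κ f (κ ν) ⟨
      coeff (mapMon κ f) (κ ν)                                             ≈⟨ ker (κ ν) ⟩
      0#                                                                   ∎

    rest-≋0 : ∀ f → mapMon κ f ≋ 0P → mapMon κ (rest f) ≋ 0P
    rest-≋0 f ker μ with Vecₚ.≡-dec ℕ._≟_ (κ ν) μ
    ... | yes ≡.refl = coeff-mapMon-all≢ κ (rest f) (all-rest f)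
    ... | no  κν≢μ   = begin
      coeff (mapMon κ (rest f)) μ                                ≈⟨ +-identityˡ _ ⟨
      0# + coeff (mapMon κ (rest f)) μ
        ≈⟨ +-congʳ (coeff-mapMon-all≢ κ (fibre f) (All.map (λ ∈fibre → κν≢μ ∘ ≡.trans (≡.sym ∈fibre)) (all-fibre f))) ⟨
      coeff (mapMon κ (fibre f)) μ + coeff (mapMon κ (rest f)) μ ≈⟨ coeff-mapMon-filter InFibre? κ f μ ⟨
      coeff (mapMon κ f) μ                                       ≈⟨ ker μ ⟩
      0#                                                         ∎

  shorter-wellFounded : WellFounded {A = Poly m} (λ f g → length f ℕ.< length g)
  shorter-wellFounded = On.wellFounded length ℕ.<-wellFounded

  mapMon-∘-≋0 : ∀ {j} (κ : Mon m → Mon k) (g : Mon k → Mon j) f → mapMon κ f ≋ 0P → mapMon (g ∘ κ) f ≋ 0P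
  mapMon-∘-≋0 κ g f = go f (shorter-wellFounded f)
    where
    go : ∀ f → Acc (λ f g → length f ℕ.< length g) f → mapMon κ f ≋ 0P → mapMon (g ∘ κ) f ≋ 0P
    go [] _ _ μ = ≈-refl
    go f@((a , ν) ∷ f′) (acc rec) ker μ = begin
      coeff (mapMon (g ∘ κ) f) μ                                             ≈⟨ coeff-mapMon-filter InFibre? (g ∘ κ) f μ ⟩
      coeff (mapMon (g ∘ κ) (fibre f)) μ + coeff (mapMon (g ∘ κ) (rest f)) μ ≈⟨ +-cong fibre-≈0 (rest-≈0 μ) ⟩
      0# + 0#                                                                ≈⟨ +-identityʳ 0# ⟩
      0#                                                                     ∎
      where
      open Fibre κ ν
      rest-≈0 : mapMon (g ∘ κ) (rest f) ≋ 0P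
      rest-≈0 = go (rest f) (rec (rest-shorter a f′)) (rest-≋0 f ker)
      fibre-≈0 : coeff (mapMon (g ∘ κ) (fibre f)) μ ≈ 0#
      fibre-≈0 with Vecₚ.≡-dec ℕ._≟_ (g (κ ν)) μ
      ... | yes gκν≡μ = ≈-trans (coeff-mapMon-all≡ (g ∘ κ) (fibre f)
                                   (All.map (λ ∈fibre → ≡.trans (≡.cong g ∈fibre) gκν≡μ) (all-fibre f)))
                                (Σc-fibre≈0 f ker)
      ... | no  gκν≢μ = coeff-mapMon-all≢ (g ∘ κ) (fibre f)
                          (All.map (λ ∈fibre → gκν≢μ ∘ ≡.trans (≡.sym (≡.cong g ∈fibre))) (all-fibre f))

  mapMon-++ : ∀ (ψ : Mon m → Mon k) f g → mapMon ψ (f ++ g) ≡ mapMon ψ f ++ mapMon ψ g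
  mapMon-++ ψ = Listₚ.map-++ _

  mapMon-neg : ∀ (ψ : Mon m → Mon k) f → mapMon ψ (-P f) ≡ -P (mapMon ψ f)
  mapMon-neg ψ f = ≡.trans (≡.sym (Listₚ.map-∘ f)) (Listₚ.map-∘ f)

  +P-≋0 : {f g : Poly m} → f ≋ 0P → g ≋ 0P → (f +P g) ≋ 0P
  +P-≋0 {f = f} {g} f≋0 g≋0 μ = ≈-trans (coeff-++ f g μ) (≈-trans (+-cong (f≋0 μ) (g≋0 μ)) (+-identityʳ 0#))

  mapMon-resp-≋ : ∀ (ψ : Mon m → Mon k) f g → f ≋ g → mapMon ψ f ≋ mapMon ψ g
  mapMon-resp-≋ ψ f g f≋g μ = x∙y⁻¹≈ε⇒x≈y _ _ (begin
    coeff (mapMon ψ f) μ + - coeff (mapMon ψ g) μ       ≈⟨ +-congˡ (coeff-neg (mapMon ψ g) μ) ⟨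
    coeff (mapMon ψ f) μ + coeff (-P mapMon ψ g) μ      ≈⟨ coeff-++ (mapMon ψ f) (-P mapMon ψ g) μ ⟨
    coeff (mapMon ψ f ++ -P mapMon ψ g) μ
      ≡⟨ ≡.cong (λ h → coeff h μ) (≡.trans (≡.cong (mapMon ψ f ++_) (≡.sym (mapMon-neg ψ g))) (≡.sym (mapMon-++ ψ f (-P g)))) ⟩
    coeff (mapMon ψ (f ++ -P g)) μ                      ≈⟨ mapMon-∘-≋0 (λ ν → ν) ψ (f ++ -P g) difference≋0 μ ⟩
    0#                                                  ∎)
    where
    open import Algebra.Properties.Ring ring using (x∙y⁻¹≈ε⇒x≈y)
    difference≋0 : mapMon (λ ν → ν) (f ++ -P g) ≋ 0P
    difference≋0 μ = begin
      coeff (mapMon (λ ν → ν) (f ++ -P g)) μ ≡⟨ ≡.cong (λ h → coeff h μ) (Listₚ.map-id (f ++ -P g)) ⟩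
      coeff (f ++ -P g) μ                    ≈⟨ coeff-++ f (-P g) μ ⟩
      coeff f μ + coeff (-P g) μ             ≈⟨ +-cong (f≋g μ) (coeff-neg g μ) ⟩
      coeff g μ + - coeff g μ                ≈⟨ -‿inverseʳ _ ⟩
      0#                                     ∎

  _·P_ : Carrier → Poly m → Poly m
  x ·P f = map (λ t → (x * proj₁ t , proj₂ t)) f

  *P-≋0 : ∀ (φ : Mon m → Mon k) → (∀ u v → φ (u ⊕ v) ≡ φ u ⊕ φ v) →
          ∀ h g → mapMon φ g ≋ 0P → mapMon φ (h *P g) ≋ 0P
  *P-≋0 φ φ-⊕ []            g ker μ = ≈-refl
  *P-≋0 φ φ-⊕ ((x , σ) ∷ h) g ker =
    ≡.subst (_≋ 0P) (≡.sym (mapMon-++ φ (map σ-times g) (h *P g)))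
      (+P-≋0 {f = mapMon φ (map σ-times g)} σ-times-≋0 (*P-≋0 φ φ-⊕ h g ker))
    where
    σ-times : Term _ → Term _
    σ-times t = (x * proj₁ t , σ ⊕ proj₂ t)
    shifted : mapMon φ (map σ-times g) ≡ mapMon ((φ σ ⊕_) ∘ φ) (x ·P g)
    shifted = ≡.trans (≡.sym (Listₚ.map-∘ g))
                (≡.trans (Listₚ.map-cong (λ t → ≡.cong (x * proj₁ t ,_) (φ-⊕ σ (proj₂ t))) g) (Listₚ.map-∘ g))
    scaled≋0 : mapMon φ (x ·P g) ≋ 0P
    scaled≋0 μ = begin
      coeff (mapMon φ (x ·P g)) μ ≡⟨ ≡.cong (λ f → coeff f μ) (≡.trans (≡.sym (Listₚ.map-∘ g)) (Listₚ.map-∘ g)) ⟩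
      coeff (x ·P mapMon φ g) μ   ≈⟨ coeff-scale x (mapMon φ g) μ ⟩
      x * coeff (mapMon φ g) μ    ≈⟨ *-congˡ (ker μ) ⟩
      x * 0#                      ≈⟨ zeroʳ x ⟩
      0#                          ∎
    σ-times-≋0 : mapMon φ (map σ-times g) ≋ 0P
    σ-times-≋0 = ≡.subst (_≋ 0P) (≡.sym shifted) (mapMon-∘-≋0 φ (φ σ ⊕_) (x ·P g) scaled≋0)

  binomial : Carrier → Mon m → Mon m → Poly m
  binomial x u v = (x , u) ∷ (- x , v) ∷ []

  coeff-binomial : ∀ x (u v μ : Mon m) → coeff (binomial x u v) μ ≈ coeff ((x , u) ∷ []) μ + - coeff ((x , v) ∷ []) μ
  coeff-binomial x u v μ = ≈-trans (coeff-++ ((x , u) ∷ []) ((- x , v) ∷ []) μ) (+-congˡ (coeff-neg ((x , v) ∷ []) μ))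

  binomial-≋0 : ∀ x {u v : Mon m} → u ≡ v → binomial x u v ≋ 0P
  binomial-≋0 x {u} ≡.refl μ = ≈-trans (coeff-binomial x u u μ) (-‿inverseʳ _)

  binomial-swap : ∀ x (u v : Mon m) → binomial (- x) v u ≋ binomial x u v
  binomial-swap x u v μ = begin
    coeff (binomial (- x) v u) μ                          ≈⟨ coeff-binomial (- x) v u μ ⟩
    coeff ((- x , v) ∷ []) μ + - coeff ((- x , u) ∷ []) μ
      ≈⟨ +-cong (coeff-neg ((x , v) ∷ []) μ) (-‿cong (coeff-neg ((x , u) ∷ []) μ)) ⟩
    - B + - - A                                           ≈⟨ +-congˡ (-‿involutive A) ⟩
    - B + A                                               ≈⟨ +-comm (- B) A ⟩
    A + - B                                               ≈⟨ coeff-binomial x u v μ ⟨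
    coeff (binomial x u v) μ                              ∎
    where
    open import Algebra.Properties.Ring ring using (-‿involutive)
    A = coeff ((x , u) ∷ []) μ
    B = coeff ((x , v) ∷ []) μ

  binomial-trans : ∀ x (u v w : Mon m) → (binomial x u v +P binomial x v w) ≋ binomial x u w
  binomial-trans x u v w μ = begin
    coeff (binomial x u v +P binomial x v w) μ ≈⟨ coeff-++ (binomial x u v) (binomial x v w) μ ⟩
    coeff (binomial x u v) μ + coeff (binomial x v w) μ ≈⟨ +-cong (coeff-binomial x u v μ) (coeff-binomial x v w μ) ⟩
    (A + - B) + (B + - C)                      ≈⟨ +-assoc A (- B) (B + - C) ⟩
    A + (- B + (B + - C))                      ≈⟨ +-congˡ (+-assoc (- B) B (- C)) ⟨
    A + ((- B + B) + - C)                      ≈⟨ +-congˡ (+-congʳ (-‿inverseˡ B)) ⟩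
    A + (0# + - C)                             ≈⟨ +-congˡ (+-identityˡ (- C)) ⟩
    A + - C                                    ≈⟨ coeff-binomial x u w μ ⟨
    coeff (binomial x u w) μ                   ∎
    where
    A = coeff ((x , u) ∷ []) μ
    B = coeff ((x , v) ∷ []) μ
    C = coeff ((x , w) ∷ []) μ

  combination : List (Poly m × Poly m) → Poly m
  combination hs = sumP (map (λ hg → proj₁ hg *P proj₂ hg) hs)

  combination-++ : ∀ (hs hs′ : List (Poly m × Poly m)) → combination hs ++ combination hs′ ≡ combination (hs ++ hs′)
  combination-++ hs hs′ = ≡.trans (Listₚ.concat-++ (map _ hs) (map _ hs′)) (≡.cong concat (≡.sym (Listₚ.map-++ _ hs hs′)))

  module _ {g} (G : Poly m → Set g) where

    ∈⟨⟩-resp-≋ : ∀ f f′ → f ≋ f′ → f ∈⟨ G ⟩ → f′ ∈⟨ G ⟩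
    ∈⟨⟩-resp-≋ _ _ f≋f′ (hs , generators , f≋) = hs , generators , λ μ → ≈-trans (≈-sym (f≋f′ μ)) (f≋ μ)

    ≋0⇒∈⟨⟩ : ∀ f → f ≋ 0P → f ∈⟨ G ⟩
    ≋0⇒∈⟨⟩ _ f≋0 = [] , [] , f≋0

    +P-∈⟨⟩ : ∀ f f′ → f ∈⟨ G ⟩ → f′ ∈⟨ G ⟩ → (f +P f′) ∈⟨ G ⟩
    +P-∈⟨⟩ f f′ (hs , generators , f≋) (hs′ , generators′ , f′≋) =
      hs ++ hs′ , Allₚ.++⁺ generators generators′ , λ μ → begin
        coeff (f ++ f′) μ                            ≈⟨ coeff-++ f f′ μ ⟩
        coeff f μ + coeff f′ μ                       ≈⟨ +-cong (f≋ μ) (f′≋ μ) ⟩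
        coeff (combination hs) μ + coeff (combination hs′) μ ≈⟨ coeff-++ (combination hs) (combination hs′) μ ⟨
        coeff (combination hs ++ combination hs′) μ  ≡⟨ ≡.cong (λ h → coeff h μ) (combination-++ hs hs′) ⟩
        coeff (combination (hs ++ hs′)) μ            ∎

    multiple-∈⟨⟩ : ∀ h {g} → G g → (h *P g) ∈⟨ G ⟩
    multiple-∈⟨⟩ h {g} Gg = (h , g) ∷ [] , Gg ∷ [] , λ μ → ≈-sym (≈-trans (coeff-++ (h *P g) [] μ) (+-identityʳ _))

module HibiFibres {c ℓ : Level} (K : Field c ℓ) (L : FinDistLattice) (open? : Fin (FinDistLattice.size L) → Bool) where
  open HibiType K L open?
  open import Data.Nat using (_+_; _*_)
  open FinDistLatticeProperties L
  open Odot L open?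

  φMon-⊕ : ∀ u v → φMon (u ⊕ v) ≡ φMon u ⊕ φMon v
  φMon-⊕ u v = cong₂ _∷_ total (trans (Vecₚ.tabulate-cong weighted) (sym (⊕-tabulate _ _)))
    where
    total : sumℕ (map (lookup (u ⊕ v)) elts) ≡ sumℕ (map (lookup u) elts) + sumℕ (map (lookup v) elts)
    total = trans (cong sum (Listₚ.map-cong (lookup-⊕ u v) elts)) (sum-map-+ (lookup u) (lookup v) elts)
    weighted : ∀ p → sumℕ (map (λ a → lookup (u ⊕ v) a * 𝟏 (inK a p)) elts)
                   ≡ sumℕ (map (λ a → lookup u a * 𝟏 (inK a p)) elts) + sumℕ (map (λ a → lookup v a * 𝟏 (inK a p)) elts)
    weighted p = trans (cong sum (Listₚ.map-cong (λ a → trans (cong (_* 𝟏 (inK a p)) (lookup-⊕ u v a))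
                                                               (ℕₚ.*-distribʳ-+ (𝟏 (inK a p)) (lookup u a) (lookup v a))) elts))
                       (sum-map-+ (λ a → lookup u a * 𝟏 (inK a p)) (λ a → lookup v a * 𝟏 (inK a p)) elts)

  φMon-unit : ∀ a → φMon (unit a) ≡ 1 ∷ tabulate (λ p → 𝟏 (inK a p))
  φMon-unit a = cong₂ _∷_
    (trans (cong sum (Listₚ.map-cong (λ b → sym (ℕₚ.*-identityʳ (lookup (unit a) b))) elts)) (sum-map-allFin-unit a (λ _ → 1)))
    (Vecₚ.tabulate-cong λ p → sum-map-allFin-unit a (λ b → 𝟏 (inK b p)))

  φMon-𝟎 : φMon 𝟎 ≡ 𝟎
  φMon-𝟎 = ⊕-cancelˡ (φMon 𝟎) (begin
    φMon 𝟎 ⊕ φMon 𝟎   ≡⟨ φMon-⊕ 𝟎 𝟎 ⟨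
    φMon (𝟎 ⊕ 𝟎)      ≡⟨ cong φMon (⊕-identityˡ 𝟎) ⟩
    φMon 𝟎            ≡⟨ ⊕-identityˡ (φMon 𝟎) ⟨
    𝟎 ⊕ φMon 𝟎        ≡⟨ ⊕-comm 𝟎 (φMon 𝟎) ⟩
    φMon 𝟎 ⊕ 𝟎        ∎)
    where open ≡-Reasoning

  φMon-move : ∀ {a b d} → IsOdot a b d → φMon (unit a) ⊕ φMon (unit b) ≡ φMon (unit (a ⊔ᴸ b)) ⊕ φMon (unit d)
  φMon-move {a} {b} {d} odot = begin
    φMon (unit a) ⊕ φMon (unit b)
      ≡⟨ cong₂ _⊕_ (φMon-unit a) (φMon-unit b) ⟩
    2 ∷ (tabulate (𝟏 ∘ inK a) ⊕ tabulate (𝟏 ∘ inK b))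
      ≡⟨ cong (2 ∷_) (trans (⊕-tabulate _ _)
                       (trans (Vecₚ.tabulate-cong (IsOdot⇒indicator-sum odot)) (sym (⊕-tabulate _ _)))) ⟩
    2 ∷ (tabulate (𝟏 ∘ inK (a ⊔ᴸ b)) ⊕ tabulate (𝟏 ∘ inK d))
      ≡⟨ cong₂ _⊕_ (φMon-unit (a ⊔ᴸ b)) (φMon-unit d) ⟨
    φMon (unit (a ⊔ᴸ b)) ⊕ φMon (unit d) ∎
    where open ≡-Reasoning

  φMon-pair : ∀ {a b d} → IsOdot a b d → φMon (unit a ⊕ unit b) ≡ φMon (unit (a ⊔ᴸ b) ⊕ unit d)
  φMon-pair {a} {b} {d} odot =
    trans (φMon-⊕ (unit a) (unit b)) (trans (φMon-move odot) (sym (φMon-⊕ (unit (a ⊔ᴸ b)) (unit d))))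

  data Move : Mon size → Mon size → Set where
    move : ∀ {a b} r → Incomparable a b → Move (unit a ⊕ (unit b ⊕ r)) (unit (a ⊔ᴸ b) ⊕ (unit (a ⊙ b) ⊕ r))

  Connected : Mon size → Mon size → Set
  Connected = EqClosure Move

  open IsEquivalence (EqClosure.isEquivalence Move) public
    using () renaming (refl to Connected-refl; sym to Connected-sym; trans to Connected-trans; reflexive to ≡⇒Connected)

  Connected-shift : ∀ x {u v} → Connected u v → Connected (unit x ⊕ u) (unit x ⊕ v)
  Connected-shift x = EqClosure.gfold (EqClosure.isEquivalence Move) (unit x ⊕_) shifted-move
    where
    shifted-move : ∀ {u v} → Move u v → Connected (unit x ⊕ u) (unit x ⊕ v)
    shifted-move (move {a} {b} r a∥b) =
      Connected-trans (≡⇒Connected (push-in a b r))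
        (Connected-trans (EqClosure.return (move (unit x ⊕ r) a∥b)) (≡⇒Connected (sym (push-in (a ⊔ᴸ b) (a ⊙ b) r))))
      where
      push-in : ∀ a b r → unit x ⊕ (unit a ⊕ (unit b ⊕ r)) ≡ unit a ⊕ (unit b ⊕ (unit x ⊕ r))
      push-in a b r = trans (⊕-swap (unit x) (unit a) _) (cong (unit a ⊕_) (⊕-swap (unit x) (unit b) r))

  Connected⇒φMon≡ : ∀ {u v} → Connected u v → φMon u ≡ φMon v
  Connected⇒φMon≡ = EqClosure.gfold ≡.isEquivalence φMon φMon-preserves-move
    where
    φMon-⊕-assoc : ∀ u v w → φMon (u ⊕ (v ⊕ w)) ≡ (φMon u ⊕ φMon v) ⊕ φMon w
    φMon-⊕-assoc u v w =
      trans (φMon-⊕ u (v ⊕ w)) (trans (cong (φMon u ⊕_) (φMon-⊕ v w)) (sym (⊕-assoc (φMon u) (φMon v) (φMon w))))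
    φMon-preserves-move : ∀ {u v} → Move u v → φMon u ≡ φMon v
    φMon-preserves-move (move {a} {b} r _) = begin
      φMon (unit a ⊕ (unit b ⊕ r))                          ≡⟨ φMon-⊕-assoc (unit a) (unit b) r ⟩
      (φMon (unit a) ⊕ φMon (unit b)) ⊕ φMon r              ≡⟨ cong (_⊕ φMon r) (φMon-move (⊙-isOdot a b)) ⟩
      (φMon (unit (a ⊔ᴸ b)) ⊕ φMon (unit (a ⊙ b))) ⊕ φMon r ≡⟨ φMon-⊕-assoc (unit (a ⊔ᴸ b)) (unit (a ⊙ b)) r ⟨
      φMon (unit (a ⊔ᴸ b) ⊕ (unit (a ⊙ b) ⊕ r))             ∎
      where open ≡-Reasoning

  join-step : ∀ m a → ∃ λ z → ∀ r → Connected (unit m ⊕ (unit a ⊕ r)) (unit (m ⊔ᴸ a) ⊕ (unit z ⊕ r))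
  join-step m a with a ≤? m | m ≤? a
  ... | yes a≤m | _       = a , λ r →
    ≡⇒Connected (cong (λ y → unit y ⊕ (unit a ⊕ r)) (sym (trans (⊔-comm m a) a≤m)))
  ... | no _    | yes m≤a = m , λ r →
    ≡⇒Connected (trans (⊕-swap (unit m) (unit a) r) (cong (λ y → unit y ⊕ (unit m ⊕ r)) (sym m≤a)))
  ... | no a≰m  | no m≰a  = m ⊙ a , λ r → EqClosure.return (move r (m≰a , a≰m))

  gather : ∀ m l → ∃ λ l′ → length l′ ≡ length l × Connected (exponent (m ∷ l)) (exponent (foldl _⊔ᴸ_ m l ∷ l′))
  gather m []      = [] , refl , Connected-refl
  gather m (a ∷ l) =
    let z , step = join-step m a
        l′ , length-l′ , gathered = gather (m ⊔ᴸ a) l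
    in z ∷ l′ , cong ℕ.suc length-l′ ,
       Connected-trans (step (exponent l))
         (Connected-trans (≡⇒Connected (⊕-swap (unit (m ⊔ᴸ a)) (unit z) (exponent l)))
           (Connected-trans (Connected-shift z gathered)
             (≡⇒Connected (⊕-swap (unit z) (unit (foldl _⊔ᴸ_ (m ⊔ᴸ a) l)) (exponent l′)))))

  K-degree : List Elt → Elt → ℕ
  K-degree l q = sumℕ (map (λ a → 𝟏 (inK a q)) l)

  lookup-φMon-exponent-∷ : ∀ a l i →
    lookup (φMon (exponent (a ∷ l))) i ≡ lookup (φMon (unit a)) i + lookup (φMon (exponent l)) i
  lookup-φMon-exponent-∷ a l i =
    trans (cong (λ w → lookup w i) (φMon-⊕ (unit a) (exponent l))) (lookup-⊕ (φMon (unit a)) (φMon (exponent l)) i)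

  degree-φMon-exponent : ∀ l → lookup (φMon (exponent l)) zero ≡ length l
  degree-φMon-exponent []      = cong (λ w → lookup w zero) φMon-𝟎
  degree-φMon-exponent (a ∷ l) = trans (lookup-φMon-exponent-∷ a l zero)
    (cong₂ _+_ (cong (λ w → lookup w zero) (φMon-unit a)) (degree-φMon-exponent l))

  K-degree-φMon-exponent : ∀ l q → lookup (φMon (exponent l)) (suc q) ≡ K-degree l q
  K-degree-φMon-exponent []      q = trans (cong (λ w → lookup w (suc q)) φMon-𝟎) (Vecₚ.lookup-replicate q 0)
  K-degree-φMon-exponent (a ∷ l) q = trans (lookup-φMon-exponent-∷ a l (suc q))
    (cong₂ _+_ (trans (cong (λ w → lookup w (suc q)) (φMon-unit a)) (Vecₚ.lookup∘tabulate (𝟏 ∘ inK a) q))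
               (K-degree-φMon-exponent l q))

  sum-𝟏≢0⇔Any : ∀ {A : Set} (f : A → Bool) xs → sumℕ (map (𝟏 ∘ f) xs) ≢ 0 ⇔ Any (T ∘ f) xs
  sum-𝟏≢0⇔Any {A} f xs = mk⇔ (sound xs) (complete xs)
    where
    sound : ∀ xs → sumℕ (map (𝟏 ∘ f) xs) ≢ 0 → Any (T ∘ f) xs
    sound []       sum≢0 = contradiction refl sum≢0
    sound (x ∷ xs) sum≢0 with f x in fx
    ... | true  = here (subst T (sym fx) _)
    ... | false = there (sound xs sum≢0)
    complete : ∀ xs → Any (T ∘ f) xs → sumℕ (map (𝟏 ∘ f) xs) ≢ 0
    complete (x ∷ xs) (here fx) with f x
    ... | true = λ ()
    complete (x ∷ xs) (there fxs) sum≡0 = complete xs fxs (ℕₚ.m+n≡0⇒n≡0 (𝟏 (f x)) sum≡0)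

  Any-≤⇔Any-InK : ∀ {p} → JoinIrreducible p → ∀ l → Any (p ≤_) l ⇔ ∃ λ q → p ≤ q × Any (λ a → InK a q) l
  Any-≤⇔Any-InK p-JI l = mk⇔ (sound l) (λ (q , p≤q , q∈K) → Any.map (λ (_ , q≤a , _) → ≤-trans p≤q q≤a) q∈K)
    where
    sound : ∀ l → Any (_ ≤_) l → ∃ λ q → _ ≤ q × Any (λ a → InK a q) l
    sound (a ∷ l) (here p≤a)   = let q , p≤q , q∈Ka = maximal-JI-above p-JI p≤a in q , p≤q , here q∈Ka
    sound (a ∷ l) (there p≤l) = let q , p≤q , q∈K = sound l p≤l in q , p≤q , there q∈K

  φMon≡⇒Any-≤ : ∀ {l₁ l₂} → φMon (exponent l₁) ≡ φMon (exponent l₂) →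
                ∀ {p} → JoinIrreducible p → Any (p ≤_) l₁ → Any (p ≤_) l₂
  φMon≡⇒Any-≤ {l₁} {l₂} same p-JI p≤l₁ =
    let q , p≤q , q∈K₁ = to (Any-≤⇔Any-InK p-JI l₁) p≤l₁
        K-degrees-equal = trans (sym (K-degree-φMon-exponent l₁ q))
                                (trans (cong (λ w → lookup w (suc q)) same) (K-degree-φMon-exponent l₂ q))
        q∈K₂ = to (sum-𝟏≢0⇔Any (λ a → inK a q) l₂)
                  (subst (_≢ 0) K-degrees-equal
                    (from (sum-𝟏≢0⇔Any (λ a → inK a q) l₁) (Any.map (λ {a} → from (T-inK⇔ a q)) q∈K₁)))
    in from (Any-≤⇔Any-InK p-JI l₂) (q , p≤q , Any.map (λ {a} → to (T-inK⇔ a q)) q∈K₂)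

  φMon≡⇒length≡ : ∀ l₁ l₂ → φMon (exponent l₁) ≡ φMon (exponent l₂) → length l₁ ≡ length l₂
  φMon≡⇒length≡ l₁ l₂ same =
    trans (sym (degree-φMon-exponent l₁)) (trans (cong (λ w → lookup w zero) same) (degree-φMon-exponent l₂))

  exponent-fibre-connected : ∀ n l₁ l₂ → length l₁ ≡ n →
    φMon (exponent l₁) ≡ φMon (exponent l₂) → Connected (exponent l₁) (exponent l₂)
  exponent-fibre-connected _ []        []        _ _    = Connected-refl
  exponent-fibre-connected _ []        (_ ∷ l₂)  _ same = contradiction (φMon≡⇒length≡ [] (_ ∷ l₂) same) ℕₚ.0≢1+n
  exponent-fibre-connected _ (_ ∷ l₁)  []        _ same = contradiction (sym (φMon≡⇒length≡ (_ ∷ l₁) [] same)) ℕₚ.0≢1+n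
  exponent-fibre-connected (ℕ.suc n) (m₁ ∷ t₁) (m₂ ∷ t₂) length≡ same =
    Connected-trans gathered₁
      (Connected-trans (Connected-shift x₁ rest-connected)
        (Connected-trans (≡⇒Connected (cong (λ x → unit x ⊕ exponent l₂′) joins-equal)) (Connected-sym gathered₂)))
    where
    x₁ = foldl _⊔ᴸ_ m₁ t₁
    x₂ = foldl _⊔ᴸ_ m₂ t₂
    gathering₁ = gather m₁ t₁
    gathering₂ = gather m₂ t₂
    l₁′ = proj₁ gathering₁
    l₂′ = proj₁ gathering₂
    gathered₁ = proj₂ (proj₂ gathering₁)
    gathered₂ = proj₂ (proj₂ gathering₂)
    joins-equal : x₁ ≡ x₂
    joins-equal = ≡-by-JI λ p-JI → mk⇔
      (from (JI-≤-foldl-⊔⇔ p-JI m₂ t₂) ∘ φMon≡⇒Any-≤ same p-JI ∘ to (JI-≤-foldl-⊔⇔ p-JI m₁ t₁))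
      (from (JI-≤-foldl-⊔⇔ p-JI m₁ t₁) ∘ φMon≡⇒Any-≤ (sym same) p-JI ∘ to (JI-≤-foldl-⊔⇔ p-JI m₂ t₂))
    rest-same : φMon (exponent l₁′) ≡ φMon (exponent l₂′)
    rest-same = ⊕-cancelˡ (φMon (unit x₁)) (begin
      φMon (unit x₁) ⊕ φMon (exponent l₁′)  ≡⟨ φMon-⊕ (unit x₁) (exponent l₁′) ⟨
      φMon (exponent (x₁ ∷ l₁′))            ≡⟨ Connected⇒φMon≡ gathered₁ ⟨
      φMon (exponent (m₁ ∷ t₁))             ≡⟨ same ⟩
      φMon (exponent (m₂ ∷ t₂))             ≡⟨ Connected⇒φMon≡ gathered₂ ⟩
      φMon (exponent (x₂ ∷ l₂′))            ≡⟨ cong (λ x → φMon (exponent (x ∷ l₂′))) joins-equal ⟨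
      φMon (exponent (x₁ ∷ l₂′))            ≡⟨ φMon-⊕ (unit x₁) (exponent l₂′) ⟩
      φMon (unit x₁) ⊕ φMon (exponent l₂′)  ∎)
      where open ≡-Reasoning
    rest-connected : Connected (exponent l₁′) (exponent l₂′)
    rest-connected =
      exponent-fibre-connected n l₁′ l₂′ (trans (proj₁ (proj₂ gathering₁)) (ℕₚ.suc-injective length≡)) rest-same

  fibre-connected : ∀ {u v} → φMon u ≡ φMon v → Connected u v
  fibre-connected {u} {v} same with exponent-surjective u | exponent-surjective v
  ... | l₁ , refl | l₂ , refl = exponent-fibre-connected _ l₁ l₂ refl same

module HibiIdeal {c ℓ : Level} (K : Field c ℓ) (L : FinDistLattice) (open? : Fin (FinDistLattice.size L) → Bool) where
  open HibiType K L open?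
  open Field K using (commutativeRing)
  open CommutativeRing commutativeRing hiding (refl; sym; trans)
  open CommutativeRing commutativeRing using () renaming (refl to ≈-refl; sym to ≈-sym; trans to ≈-trans)
  open PolynomialProperties commutativeRing
  open Odot L open? using (_⊙_; ⊙-isOdot)
  open HibiFibres K L open?
  open import Algebra.Properties.Ring ring using (-‿distribʳ-*; -0#≈0#; -‿+-comm)
  open import Algebra.Properties.CommutativeSemigroup +-commutativeSemigroup using (x∙yz≈y∙xz)
  open import Relation.Binary.Reasoning.Setoid setoid

  pair-binomial : Elt → Elt → Elt → Poly size
  pair-binomial a b d = (X a *P X b) +P (-P (X (a ⊔ᴸ b) *P X d))

  generator-∈-kernel : ∀ {g} → Generator g → InKernel g
  generator-∈-kernel (_ , _ , _ , _ , odot , ≡.refl) = binomial-≋0 (1# * 1#) (φMon-pair odot)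

  ideal⊆kernel : ∀ f → f ∈⟨ Generator ⟩ → InKernel f
  ideal⊆kernel f (hs , generators , f≋) μ =
    ≈-trans (mapMon-resp-≋ φMon f (combination hs) f≋ μ) (combination-∈-kernel hs generators μ)
    where
    combination-∈-kernel : ∀ hs → All (λ hg → Generator (proj₂ hg)) hs → InKernel (combination hs)
    combination-∈-kernel []             []                  = λ _ → ≈-refl
    combination-∈-kernel ((h , g) ∷ hs) (generator ∷ generators) =
      ≡.subst (_≋ 0P) (≡.sym (mapMon-++ φMon (h *P g) _))
        (+P-≋0 {f = mapMon φMon (h *P g)} (*P-≋0 φMon φMon-⊕ h g (generator-∈-kernel generator))
                                          (combination-∈-kernel hs generators))

  Binomials : Mon size → Mon size → Set _
  Binomials u v = ∀ x → binomial x u v ∈⟨ Generator ⟩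

  Binomials-isEquivalence : IsEquivalence Binomials
  Binomials-isEquivalence = record
    { refl  = λ {u} x → ≋0⇒∈⟨⟩ Generator (binomial x u u) (binomial-≋0 x {u} ≡.refl)
    ; sym   = λ {u} {v} u~v x →
        ∈⟨⟩-resp-≋ Generator (binomial (- x) u v) (binomial x v u) (binomial-swap x v u) (u~v (- x))
    ; trans = λ {u} {v} {w} u~v v~w x →
        ∈⟨⟩-resp-≋ Generator (binomial x u v +P binomial x v w) (binomial x u w) (binomial-trans x u v w)
          (+P-∈⟨⟩ Generator (binomial x u v) (binomial x v w) (u~v x) (v~w x))
    }

  Move⇒Binomials : ∀ {u v} → Move u v → Binomials u v
  Move⇒Binomials (move {a} {b} r a∥b) x =
    ∈⟨⟩-resp-≋ Generator (((x , r) ∷ []) *P pair-binomial a b (a ⊙ b))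
      (binomial x (unit a ⊕ (unit b ⊕ r)) (unit (a ⊔ᴸ b) ⊕ (unit (a ⊙ b) ⊕ r)))
      (termwise-≋ ((x·1≈x , rearrange a b) ∷ (x·-1≈-x , rearrange (a ⊔ᴸ b) (a ⊙ b)) ∷ []))
      (multiple-∈⟨⟩ Generator ((x , r) ∷ []) (a , b , a ⊙ b , a∥b , ⊙-isOdot a b , ≡.refl))
    where
    x·1≈x : x * (1# * 1#) ≈ x
    x·1≈x = ≈-trans (*-congˡ (*-identityˡ 1#)) (*-identityʳ x)
    x·-1≈-x : x * - (1# * 1#) ≈ - x
    x·-1≈-x = ≈-trans (*-congˡ (-‿cong (*-identityˡ 1#))) (≈-trans (≈-sym (-‿distribʳ-* x 1#)) (-‿cong (*-identityʳ x)))
    rearrange : ∀ a b → r ⊕ (unit a ⊕ unit b) ≡ unit a ⊕ (unit b ⊕ r)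
    rearrange a b = ≡.trans (⊕-comm r _) (⊕-assoc (unit a) (unit b) r)

  Connected⇒Binomials : ∀ {u v} → Connected u v → Binomials u v
  Connected⇒Binomials = EqClosure.fold Binomials-isEquivalence Move⇒Binomials

  fibre-∈⟨⟩ : ∀ ν T → All (λ t → φMon (proj₂ t) ≡ φMon ν) T → (T +P ((- Σc T , ν) ∷ [])) ∈⟨ Generator ⟩
  fibre-∈⟨⟩ ν [] [] = ≋0⇒∈⟨⟩ Generator ((- 0# , ν) ∷ []) λ μ →
    ≈-trans (coeff-neg ((0# , ν) ∷ []) μ) (≈-trans (-‿cong (coeff-single-≈0 ≈-refl ν μ)) -0#≈0#)
  fibre-∈⟨⟩ ν ((x , ν′) ∷ T) (same ∷ same-T) =
    ∈⟨⟩-resp-≋ Generator (binomial x ν′ ν +P (T +P ((- Σc T , ν) ∷ [])))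
                         (((x , ν′) ∷ T) +P ((- (x + Σc T) , ν) ∷ [])) regroup
      (+P-∈⟨⟩ Generator (binomial x ν′ ν) (T +P ((- Σc T , ν) ∷ []))
        (Connected⇒Binomials (fibre-connected {ν′} {ν} same) x) (fibre-∈⟨⟩ ν T same-T))
    where
    regroup : (binomial x ν′ ν +P (T +P ((- Σc T , ν) ∷ []))) ≋ (((x , ν′) ∷ T) +P ((- (x + Σc T) , ν) ∷ []))
    regroup μ = begin
      coeff (binomial x ν′ ν +P (T +P ((- Σc T , ν) ∷ []))) μ
        ≈⟨ coeff-++ (binomial x ν′ ν) _ μ ⟩
      coeff (binomial x ν′ ν) μ + coeff (T +P ((- Σc T , ν) ∷ [])) μ
        ≈⟨ +-cong (coeff-binomial x ν′ ν μ) (≈-trans (coeff-++ T _ μ) (+-congˡ (coeff-neg ((Σc T , ν) ∷ []) μ))) ⟩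
      (A + - B) + (C + - S)
        ≈⟨ +-assoc A (- B) (C + - S) ⟩
      A + (- B + (C + - S))
        ≈⟨ +-congˡ (x∙yz≈y∙xz (- B) C (- S)) ⟩
      A + (C + (- B + - S))
        ≈⟨ +-congˡ (+-congˡ (-‿+-comm B S)) ⟩
      A + (C + - (B + S))
        ≈⟨ +-congˡ (+-congˡ (-‿cong (coeff-single-+ x (Σc T) ν μ))) ⟨
      A + (C + - coeff ((x + Σc T , ν) ∷ []) μ)
        ≈⟨ +-congˡ (≈-trans (coeff-++ T _ μ) (+-congˡ (coeff-neg ((x + Σc T , ν) ∷ []) μ))) ⟨
      A + coeff (T +P ((- (x + Σc T) , ν) ∷ [])) μ
        ≈⟨ coeff-++ ((x , ν′) ∷ []) _ μ ⟨
      coeff (((x , ν′) ∷ T) +P ((- (x + Σc T) , ν) ∷ [])) μ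
        ∎
      where
      A = coeff ((x , ν′) ∷ []) μ
      B = coeff ((x , ν) ∷ []) μ
      C = coeff T μ
      S = coeff ((Σc T , ν) ∷ []) μ

  kernel⊆ideal : ∀ f → InKernel f → f ∈⟨ Generator ⟩
  kernel⊆ideal f = go f (shorter-wellFounded f)
    where
    go : ∀ f → Acc (λ f g → length f ℕ.< length g) f → InKernel f → f ∈⟨ Generator ⟩
    go [] _ _ = ≋0⇒∈⟨⟩ Generator [] λ _ → ≈-refl
    go f@((a , ν) ∷ f′) (acc rec) ker =
      ∈⟨⟩-resp-≋ Generator (fibre-part +P rest f) f reassemble
        (+P-∈⟨⟩ Generator fibre-part (rest f) (fibre-∈⟨⟩ ν (fibre f) (all-fibre f))
                                             (go (rest f) (rec (rest-shorter a f′)) (rest-≋0 f ker)))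
      where
      open Fibre φMon ν
      fibre-part = fibre f +P ((- Σc (fibre f) , ν) ∷ [])
      reassemble : ((fibre f +P ((- Σc (fibre f) , ν) ∷ [])) +P rest f) ≋ f
      reassemble μ = begin
        coeff ((fibre f +P ((- Σc (fibre f) , ν) ∷ [])) +P rest f) μ
          ≈⟨ ≈-trans (coeff-++ (fibre f +P _) (rest f) μ) (+-congʳ (coeff-++ (fibre f) _ μ)) ⟩
        (coeff (fibre f) μ + coeff ((- Σc (fibre f) , ν) ∷ []) μ) + coeff (rest f) μ
          ≈⟨ +-congʳ (+-congˡ (coeff-single-≈0 (≈-trans (-‿cong (Σc-fibre≈0 f ker)) -0#≈0#) ν μ)) ⟩
        (coeff (fibre f) μ + 0#) + coeff (rest f) μ
          ≈⟨ +-congʳ (+-identityʳ _) ⟩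
        coeff (fibre f) μ + coeff (rest f) μ
          ≈⟨ coeff-filter InFibre? f μ ⟨
        coeff f μ
          ∎

corollary5p4 : {c ℓ : Level} (K : Field c ℓ) (L : FinDistLattice)
    (open? : Fin (FinDistLattice.size L) → Bool) →
    let open HibiType K L open? in
    (f : Poly size) → InKernel f ⇔ (f ∈⟨ Generator ⟩)
corollary5p4 K L open? f = mk⇔ (kernel⊆ideal f) (ideal⊆kernel f)
  where open HibiIdeal K L open?
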